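{- As formal power series in $y$, \[ \sum_{n\ge0} H_n(x) y^n = \frac{1 +xy(1+y) +2xy^3(1+y) -x^2y^3(1+y)^2}{1-xy^2(1+y)} = -2y+xy+xy^2+\frac{1+2y}{1-xy^2(1+y)}. \]
   Context: For $n\ge 0$, the $S$-fence $\phi_n$ is the poset on $\{x_1,\dots,x_n\}$ whose order is generated by the cover relations $x_2<x_1$, $x_3<x_2$, $x_2<x_4$, $x_5<x_4$, and, for every $i\ge 3$, $x_{2i-1}<x_{2i}$ and $x_{2i+1}<x_{2i}$, keeping only those relations whose elements both have index $\le n$ ($\phi_0$ is empty and $\Phi_0$ is a single vertex). A filter is an up-set. $\Phi_n$ is the underlying undirected graph of the Hasse diagram of the lattice of filters of $\phi_n$ ordered by reverse inclusion (two filters adjacent iff they differ in exactly one element). A maximal $k$-dimensional cube of $\Phi_n$ is an induced subgraph isomorphic to the hypercube $Q_k$ (with $Q_0$ a single vertex) not contained in any induced hypercube subgraph of larger dimension; $h_{n,k}$ is their number and $H_n(x)=\sum_{k\ge0}h_{n,k}x^k$. -}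

module Defs where

open import Data.Nat using (ℕ; zero; suc; _<_; _≤_; _*_; _∸_)
import Data.Nat as N
open import Data.Integer as ℤ using (ℤ; +_; -_)
open import Data.Fin using (Fin; toℕ)
open import Data.Bool using (Bool; true; false; _≟_)
open import Data.Vec using (Vec; []; _∷_)
open import Data.Fin.Subset using (Subset; _∈_)
open import Data.List using (List; length)
open import Data.List.Relation.Unary.All using (All)
open import Data.List.Relation.Unary.Any using (Any)
open import Data.List.Relation.Unary.AllPairs using (AllPairs)
open import Data.Product using (Σ; ∃; _×_)
open import Relation.Binary.PropositionalEquality using (_≡_)
open import Relation.Binary.Construct.Closure.ReflexiveTransitive using (Star)
open import Relation.Nullary using (¬_; yes; no)
open import Function.Bundles using (_⇔_)

-- The S-fence φ_n.  Elements x_1,…,x_n; x_{t+1} is represented by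
-- t : Fin n.  'Cover a b' (1-based indices) means the cover relation
-- x_a < x_b.

data Cover : ℕ → ℕ → Set where
  c21 : Cover 2 1
  c32 : Cover 3 2
  c24 : Cover 2 4
  c54 : Cover 5 4
  cOdd₋ : ∀ i → 3 ≤ i → Cover (2 * i ∸ 1) (2 * i)
  cOdd₊ : ∀ i → 3 ≤ i → Cover (2 * i N.+ 1) (2 * i)

CoverFin : (n : ℕ) → Fin n → Fin n → Set
CoverFin n a b = Cover (suc (toℕ a)) (suc (toℕ b))

LeqΦ : (n : ℕ) → Fin n → Fin n → Set
LeqΦ n = Star (CoverFin n)

IsFilter : (n : ℕ) → Subset n → Set
IsFilter n F = ∀ (a b : Fin n) → LeqΦ n a b → a ∈ F → b ∈ F

-- Adjacency: two subsets differ in exactly one element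
-- (Hamming distance 1).  Used both for Φ_n and for the hypercube Q_k,
-- whose vertices are Vec Bool k.

diffCount : {m : ℕ} → Vec Bool m → Vec Bool m → ℕ
diffCount [] [] = 0
diffCount (a ∷ u) (b ∷ v) with a ≟ b
... | yes _ = diffCount u v
... | no _  = suc (diffCount u v)

Adj : {m : ℕ} → Vec Bool m → Vec Bool m → Set
Adj u v = diffCount u v ≡ 1

-- Induced hypercubes of Φ_n.  A set of vertices of Φ_n is given by its
-- characteristic function χ : Subset n → Bool.

-- f is an isomorphism of Q_k onto the induced subgraph of Φ_n on its image
CubeEmb : (n k : ℕ) → (Vec Bool k → Subset n) → Set
CubeEmb n k f =
  (∀ a → IsFilter n (f a)) ×
  (∀ a b → f a ≡ f b → a ≡ b) ×
  (∀ a b → Adj (f a) (f b) ⇔ Adj a b)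

IsCube : (n k : ℕ) → (Subset n → Bool) → Set
IsCube n k χ = Σ (Vec Bool k → Subset n) λ f →
  CubeEmb n k f × (∀ v → (χ v ≡ true) ⇔ ∃ λ a → f a ≡ v)

_⊆ᵥ_ : {n : ℕ} → (Subset n → Bool) → (Subset n → Bool) → Set
χ ⊆ᵥ ψ = ∀ v → χ v ≡ true → ψ v ≡ true

_≗ᵥ_ : {n : ℕ} → (Subset n → Bool) → (Subset n → Bool) → Set
χ ≗ᵥ ψ = ∀ v → χ v ≡ ψ v

IsMaxCube : (n k : ℕ) → (Subset n → Bool) → Set
IsMaxCube n k χ =
  IsCube n k χ × (∀ j ψ → k < j → IsCube n j ψ → ¬ (χ ⊆ᵥ ψ))

-- "Φ_n has exactly c maximal k-dimensional cubes":
-- a duplicate-free list (as vertex sets) enumerating all of them.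
MaxCubeCount : (n k c : ℕ) → Set
MaxCubeCount n k c = Σ (List (Subset n → Bool)) λ L →
  length L ≡ c ×
  All (IsMaxCube n k) L ×
  AllPairs (λ χ ψ → ¬ (χ ≗ᵥ ψ)) L ×
  (∀ χ → IsMaxCube n k χ → Any (χ ≗ᵥ_) L)

-- Formal power series in y with polynomial (in x) integer coefficients,
-- represented by coefficient functions: s n k = [x^k y^n] s.

Ser : Set
Ser = ℕ → ℕ → ℤ

sumTo : ℕ → (ℕ → ℤ) → ℤ
sumTo zero f = f 0
sumTo (suc n) f = sumTo n f ℤ.+ f (suc n)

_⊕_ : Ser → Ser → Ser
(s ⊕ t) n k = s n k ℤ.+ t n k

⊖_ : Ser → Ser
(⊖ s) n k = - s n k

_⊝_ : Ser → Ser → Ser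
s ⊝ t = s ⊕ (⊖ t)

_⊛_ : Ser → Ser → Ser
(s ⊛ t) n k = sumTo n λ i → sumTo k λ j → s i j ℤ.* t (n ∸ i) (k ∸ j)

infixl 6 _⊕_ _⊝_
infixl 7 _⊛_

const : ℤ → Ser
const c zero zero = c
const c _ _ = + 0

𝟙 : Ser
𝟙 = const (+ 1)

X : Ser
X zero (suc zero) = + 1
X _ _ = + 0

Y : Ser
Y (suc zero) zero = + 1
Y _ _ = + 0

_^ˢ_ : Ser → ℕ → Ser
s ^ˢ zero = 𝟙
s ^ˢ suc m = s ⊛ (s ^ˢ m)

infixr 8 _^ˢ_

infix 4 _≋_

_≋_ : Ser → Ser → Set
s ≋ t = ∀ n k → s n k ≡ t n k

genSer : (ℕ → ℕ → ℕ) → Ser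
genSer h n k = + h n k

Den : Ser
Den = 𝟙 ⊝ X ⊛ Y ^ˢ 2 ⊛ (𝟙 ⊕ Y)

Num : Ser
Num = 𝟙 ⊕ X ⊛ Y ⊛ (𝟙 ⊕ Y)
        ⊕ const (+ 2) ⊛ X ⊛ Y ^ˢ 3 ⊛ (𝟙 ⊕ Y)
        ⊝ X ^ˢ 2 ⊛ Y ^ˢ 3 ⊛ (𝟙 ⊕ Y) ^ˢ 2

Pol : Ser
Pol = ⊖ (const (+ 2) ⊛ Y) ⊕ X ⊛ Y ⊕ X ⊛ Y ^ˢ 2

-- Φ_n is the subgraph of the n-cube induced on the filters of φ_n, and an induced k-cube of
-- the n-cube is a subcube: the vectors matching a pattern in {0,1,∗}ⁿ with k stars. Such a
-- subcube consists of filters iff no cover a ⋖ b has a possibly 1 and b possibly 0, and it is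
-- a maximal cube of Φ_n iff moreover every fixed coordinate has a Hasse neighbour forbidding
-- its release. Along the S-fence these local conditions are read by an automaton walking the
-- zigzag x₄ x₅ … after a head x₁ x₂ x₃ with exactly one free entry. Counting its runs gives
-- h_{n+6,k+1} = h_{n+4,k} + h_{n+3,k}, so multiplying the generating function by 1 − xy²(1+y)
-- leaves finitely many coefficients, which are compared with the numerator.
module Submission where

open import Defs
open import Data.Nat using (ℕ)
open import Data.Product using (Σ; _×_; _,_)

module MaximalCubes where

  open import Data.Bool as Bool using (Bool; true; false; not; T; _∧_; _∨_; if_then_else_)
  open import Data.Bool.ListAction using (all; any)
  open import Data.Bool.Properties using (not-involutive; not-¬; ¬-not; ⇔→≡; ∧-zeroʳ; T-∧; T-∨; T?)
  open import Data.Fin using (Fin; zero; suc; _≟_; toℕ)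
  open import Data.Fin.Subset as Subset using (Subset)
  open import Data.List as List using (List; []; _∷_; _++_; length)
  import Data.List.Properties as List
  open import Data.List.Membership.Propositional using (_∈_; find; lose)
  open import Data.List.Membership.Propositional.Properties
    using (∈-map⁺; ∈-map⁻; ∈-++⁺ˡ; ∈-++⁺ʳ; ∈-++⁻)
  open import Data.List.Relation.Binary.Disjoint.Propositional using (Disjoint)
  open import Data.List.Relation.Unary.All as All using (All; []; _∷_)
  import Data.List.Relation.Unary.All.Properties as All
  open import Data.List.Relation.Unary.AllPairs as AllPairs using ([]; _∷_)
  import Data.List.Relation.Unary.AllPairs.Properties as AllPairs
  open import Data.List.Relation.Unary.Any as Any using (Any; here; there)
  import Data.List.Relation.Unary.Any.Properties as Any
  open import Data.List.Relation.Unary.Unique.Propositional using (Unique)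
  import Data.List.Relation.Unary.Unique.Propositional.Properties as Unique
  open import Data.Maybe using (Maybe; just; nothing)
  open import Data.Nat using (zero; suc; _+_; _*_; _∸_; _<_; s≤s; z≤n)
  open import Data.Nat.Properties using (suc-injective; 1+n≢n; ≤-refl; <-trans; n<1+n; +-suc)
  open import Data.Nat.Tactic.RingSolver using (solve-∀)
  open import Data.Product as Prod using (∃; proj₁; proj₂)
  open import Data.Sum using (_⊎_; inj₁; inj₂)
  open import Data.Unit using (⊤; tt)
  open import Data.Vec as Vec using (Vec; []; _∷_; lookup; replicate; updateAt; _[_]≔_)
  open import Data.Vec.Properties
    using (∷-injectiveˡ; ∷-injectiveʳ; lookup∘update; lookup∘update′; []=⇒lookup; lookup⇒[]=)
  open import Data.Vec.Relation.Binary.Pointwise.Inductive as Pointwise using (Pointwise; []; _∷_)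
  open import Function using (_∘_; id)
  open import Function.Bundles using (_⇔_; mk⇔; Equivalence)
  open import Function.Definitions using (Injective)
  open import Relation.Binary.Construct.Closure.ReflexiveTransitive using (Star; ε; _◅_)
  open import Relation.Binary.Definitions using (Irreflexive)
  open import Relation.Binary.PropositionalEquality
  open import Relation.Nullary using (¬_; Dec; yes; no; does; isYes; contradiction)
  open import Relation.Nullary.Decidable using (toWitness; fromWitness)

  toggle : ∀ {n} → Fin n → Vec Bool n → Vec Bool n
  toggle i v = updateAt v i not

  toggle-involutive : ∀ {n} (i : Fin n) v → toggle i (toggle i v) ≡ v
  toggle-involutive zero    (b ∷ v) = cong (_∷ v) (not-involutive b)
  toggle-involutive (suc i) (b ∷ v) = cong (b ∷_) (toggle-involutive i v)

  toggle-comm : ∀ {n} (i j : Fin n) v → toggle i (toggle j v) ≡ toggle j (toggle i v)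
  toggle-comm zero    zero    v       = refl
  toggle-comm zero    (suc j) (b ∷ v) = refl
  toggle-comm (suc i) zero    (b ∷ v) = refl
  toggle-comm (suc i) (suc j) (b ∷ v) = cong (b ∷_) (toggle-comm i j v)

  not-≢ : ∀ b → not b ≢ b
  not-≢ b = not-¬ refl ∘ sym

  toggle-injective : ∀ {n} (p q : Fin n) v → toggle p v ≡ toggle q v → p ≡ q
  toggle-injective zero    zero    v       e = refl
  toggle-injective zero    (suc q) (b ∷ v) e = contradiction (∷-injectiveˡ e) (not-≢ b)
  toggle-injective (suc p) zero    (b ∷ v) e = contradiction (sym (∷-injectiveˡ e)) (not-≢ b)
  toggle-injective (suc p) (suc q) (b ∷ v) e = cong suc (toggle-injective p q v (∷-injectiveʳ e))

  toggle-cancel : ∀ {n} (s q : Fin n) v → toggle s (toggle q v) ≡ v → s ≡ q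
  toggle-cancel s q v e =
    toggle-injective s q (toggle q v) (trans e (sym (toggle-involutive q v)))

  toggle-square : ∀ {n} (r s p q : Fin n) v → p ≢ q →
                  toggle r (toggle p v) ≡ toggle s (toggle q v) → r ≡ p ⊎ r ≡ q
  toggle-square r       s       zero    zero    v       p≢q e = contradiction refl p≢q
  toggle-square zero    s       zero    (suc q) v       p≢q e = inj₁ refl
  toggle-square zero    s       (suc p) zero    v       p≢q e = inj₂ refl
  toggle-square zero    zero    (suc p) (suc q) (b ∷ v) p≢q e =
    contradiction (toggle-injective p q v (∷-injectiveʳ e)) (p≢q ∘ cong suc)
  toggle-square zero    (suc s) (suc p) (suc q) (b ∷ v) p≢q e = contradiction (∷-injectiveˡ e) (not-≢ b)
  toggle-square (suc r) zero    (suc p) (suc q) (b ∷ v) p≢q e = contradiction (sym (∷-injectiveˡ e)) (not-≢ b)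
  toggle-square (suc r) (suc s) (suc p) (suc q) (b ∷ v) p≢q e =
    Data.Sum.map (cong suc) (cong suc) (toggle-square r s p q v (p≢q ∘ cong suc) (∷-injectiveʳ e))
  toggle-square (suc r) zero    zero    (suc q) (b ∷ v) p≢q e =
    inj₂ (cong suc (toggle-injective r q v (∷-injectiveʳ e)))
  toggle-square (suc r) (suc s) zero    (suc q) (b ∷ v) p≢q e = contradiction (∷-injectiveˡ e) (not-≢ b)
  toggle-square (suc r) zero    (suc p) zero    (b ∷ v) p≢q e =
    inj₁ (cong suc (toggle-cancel r p v (∷-injectiveʳ e)))
  toggle-square (suc r) (suc s) (suc p) zero    (b ∷ v) p≢q e = contradiction (sym (∷-injectiveˡ e)) (not-≢ b)

  diffCount-∷-≡ : ∀ {n} b (u v : Vec Bool n) → diffCount (b ∷ u) (b ∷ v) ≡ diffCount u v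
  diffCount-∷-≡ b u v with b Bool.≟ b
  ... | yes _   = refl
  ... | no  b≢b = contradiction refl b≢b

  diffCount-∷-not : ∀ {n} b (u v : Vec Bool n) → diffCount (b ∷ u) (not b ∷ v) ≡ suc (diffCount u v)
  diffCount-∷-not b u v with b Bool.≟ not b
  ... | yes b≡¬b = contradiction (sym b≡¬b) (not-≢ b)
  ... | no  _    = refl

  diffCount-refl : ∀ {n} (v : Vec Bool n) → diffCount v v ≡ 0
  diffCount-refl []      = refl
  diffCount-refl (b ∷ v) = trans (diffCount-∷-≡ b v v) (diffCount-refl v)

  diffCount≡0⇒≡ : ∀ {n} (u v : Vec Bool n) → diffCount u v ≡ 0 → u ≡ v
  diffCount≡0⇒≡ []      []      e = refl
  diffCount≡0⇒≡ (a ∷ u) (b ∷ v) e with a Bool.≟ b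
  ... | yes refl = cong (a ∷_) (diffCount≡0⇒≡ u v e)

  Adj-toggle : ∀ {n} (i : Fin n) v → Adj v (toggle i v)
  Adj-toggle zero    (b ∷ v) = trans (diffCount-∷-not b v v) (cong suc (diffCount-refl v))
  Adj-toggle (suc i) (b ∷ v) = trans (diffCount-∷-≡ b v (toggle i v)) (Adj-toggle i v)

  Adj⇒toggle : ∀ {n} (u v : Vec Bool n) → Adj u v → ∃ λ i → v ≡ toggle i u
  Adj⇒toggle []      []      ()
  Adj⇒toggle (a ∷ u) (b ∷ v) e with a Bool.≟ b
  ... | yes refl = Prod.map suc (cong (a ∷_)) (Adj⇒toggle u v e)
  ... | no  a≢b  = zero , cong₂ _∷_ (¬-not (a≢b ∘ sym)) (sym (diffCount≡0⇒≡ u v (suc-injective e)))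

  commonNeighbours : ∀ {n} (p q : Fin n) v w → p ≢ q →
                     Adj (toggle p v) w → Adj (toggle q v) w →
                     w ≡ v ⊎ w ≡ toggle p (toggle q v)
  commonNeighbours p q v w p≢q adj₁ adj₂
    with Adj⇒toggle _ _ adj₁ | Adj⇒toggle _ _ adj₂
  ... | r , w≡ | s , w≡′ with toggle-square r s p q v p≢q (trans (sym w≡) w≡′)
  ...   | inj₁ refl = inj₁ (trans w≡ (toggle-involutive r v))
  ...   | inj₂ refl = inj₂ (trans w≡ (toggle-comm r p v))

  toggle-induction : ∀ {k} (P : Vec Bool k → Set) → P (replicate k false) →
                     (∀ a i → P a → P (toggle i a)) → ∀ a → P a
  toggle-induction {zero}  P base step []      = base
  toggle-induction {suc k} P base step (b ∷ a) = pick b (toggle-induction P′ base′ step′ a)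
    where
    P′ : Vec Bool k → Set
    P′ a = P (false ∷ a) × P (true ∷ a)
    base′ : P′ (replicate k false)
    base′ = base , step _ zero base
    step′ : ∀ a i → P′ a → P′ (toggle i a)
    step′ a i (p₀ , p₁) = step _ (suc i) p₀ , step _ (suc i) p₁
    pick : ∀ b → P′ a → P (b ∷ a)
    pick false = proj₁
    pick true  = proj₂

  data Entry : Set where
    fixed : Bool → Entry
    free  : Entry

  pattern O = fixed false
  pattern I = fixed true

  Pattern : ℕ → Set
  Pattern = Vec Entry

  Fits : Entry → Bool → Set
  Fits (fixed b) c = c ≡ b
  Fits free      c = ⊤

  fits? : ∀ e c → Dec (Fits e c)
  fits? (fixed b) c = c Bool.≟ b
  fits? free      c = yes tt

  fitting : (e : Entry) → ∃ (Fits e)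
  fitting (fixed b) = b , refl
  fitting free      = false , tt

  Matches : ∀ {n} → Pattern n → Vec Bool n → Set
  Matches = Pointwise Fits

  matches? : ∀ {n} (π : Pattern n) v → Dec (Matches π v)
  matches? = Pointwise.decidable fits?

  subcube : ∀ {n} → Pattern n → Subset n → Bool
  subcube π v = does (matches? π v)

  subcube⇔ : ∀ {n} {π : Pattern n} {v} → (subcube π v ≡ true) ⇔ Matches π v
  subcube⇔ {π = π} {v} with matches? π v
  ... | yes m  = mk⇔ (λ _ → m) (λ _ → refl)
  ... | no  ¬m = mk⇔ (λ ()) (λ m → contradiction m ¬m)

  freeCount : ∀ {n} → Pattern n → ℕ
  freeCount []            = 0
  freeCount (fixed _ ∷ π) = freeCount π
  freeCount (free ∷ π)    = suc (freeCount π)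

  matches-toggle : ∀ {n} (π : Pattern n) p v → lookup π p ≡ free → Matches π v → Matches π (toggle p v)
  matches-toggle (free ∷ π) zero    (b ∷ v) e (_ ∷ m) = tt ∷ m
  matches-toggle (_ ∷ π)    (suc p) (b ∷ v) e (x ∷ m) = x ∷ matches-toggle π p v e m

  matches-release : ∀ {n} (π : Pattern n) p v → Matches π v → Matches (π [ p ]≔ free) v
  matches-release (_ ∷ π) zero    (b ∷ v) (_ ∷ m) = tt ∷ m
  matches-release (_ ∷ π) (suc p) (b ∷ v) (x ∷ m) = x ∷ matches-release π p v m

  matches-release-toggle : ∀ {n} (π : Pattern n) p v → Matches π v → Matches (π [ p ]≔ free) (toggle p v)
  matches-release-toggle (_ ∷ π) zero    (b ∷ v) (_ ∷ m) = tt ∷ m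
  matches-release-toggle (_ ∷ π) (suc p) (b ∷ v) (x ∷ m) = x ∷ matches-release-toggle π p v m

  matches-release⁻ : ∀ {n} (π : Pattern n) p v → lookup π p ≢ free →
                     Matches (π [ p ]≔ free) v → Matches π v ⊎ Matches π (toggle p v)
  matches-release⁻ (fixed c ∷ π) zero (b ∷ v) _ (_ ∷ m) with b Bool.≟ c
  ... | yes b≡c = inj₁ (b≡c ∷ m)
  ... | no  b≢c = inj₂ (sym (¬-not (b≢c ∘ sym)) ∷ m)
  matches-release⁻ (free ∷ π) zero (b ∷ v) p≢free _ = contradiction refl p≢free
  matches-release⁻ (e ∷ π) (suc p) (b ∷ v) p≢free (x ∷ m) =
    Data.Sum.map (x ∷_) (x ∷_) (matches-release⁻ π p v p≢free m)

  freeCount-release : ∀ {n} (π : Pattern n) p → lookup π p ≢ free →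
                      freeCount (π [ p ]≔ free) ≡ suc (freeCount π)
  freeCount-release (fixed _ ∷ π) zero    _      = refl
  freeCount-release (free ∷ π)    zero    p≢free = contradiction refl p≢free
  freeCount-release (fixed _ ∷ π) (suc p) p≢free = freeCount-release π p p≢free
  freeCount-release (free ∷ π)    (suc p) p≢free = cong suc (freeCount-release π p p≢free)

  corner : ∀ {n} → Vec Bool n → Pattern n
  corner = Vec.map fixed

  freeCount-corner : ∀ {n} (v : Vec Bool n) → freeCount (corner v) ≡ 0
  freeCount-corner []      = refl
  freeCount-corner (b ∷ v) = freeCount-corner v

  matches-corner : ∀ {n} (v : Vec Bool n) → Matches (corner v) v
  matches-corner []      = []
  matches-corner (b ∷ v) = refl ∷ matches-corner v

  matches-corner⁻ : ∀ {n} (u v : Vec Bool n) → Matches (corner u) v → v ≡ u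
  matches-corner⁻ []      []      []      = refl
  matches-corner⁻ (a ∷ u) (b ∷ v) (x ∷ m) = cong₂ _∷_ x (matches-corner⁻ u v m)

  embed : ∀ {n} (π : Pattern n) → Vec Bool (freeCount π) → Vec Bool n
  embed []            []      = []
  embed (fixed b ∷ π) a       = b ∷ embed π a
  embed (free ∷ π)    (b ∷ a) = b ∷ embed π a

  project : ∀ {n} (π : Pattern n) → Vec Bool n → Vec Bool (freeCount π)
  project []            []      = []
  project (fixed _ ∷ π) (b ∷ v) = project π v
  project (free ∷ π)    (b ∷ v) = b ∷ project π v

  matches-embed : ∀ {n} (π : Pattern n) a → Matches π (embed π a)
  matches-embed []            []      = []
  matches-embed (fixed b ∷ π) a       = refl ∷ matches-embed π a
  matches-embed (free ∷ π)    (b ∷ a) = tt ∷ matches-embed π a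

  embed-project : ∀ {n} (π : Pattern n) v → Matches π v → embed π (project π v) ≡ v
  embed-project []            []      []         = refl
  embed-project (fixed b ∷ π) (c ∷ v) (refl ∷ m) = cong (b ∷_) (embed-project π v m)
  embed-project (free ∷ π)    (c ∷ v) (_ ∷ m)    = cong (c ∷_) (embed-project π v m)

  project-embed : ∀ {n} (π : Pattern n) a → project π (embed π a) ≡ a
  project-embed []            []      = refl
  project-embed (fixed b ∷ π) a       = project-embed π a
  project-embed (free ∷ π)    (b ∷ a) = cong (b ∷_) (project-embed π a)

  diffCount-embed : ∀ {n} (π : Pattern n) a b → diffCount (embed π a) (embed π b) ≡ diffCount a b
  diffCount-embed []            []      []      = refl
  diffCount-embed (fixed c ∷ π) a       b       =
    trans (diffCount-∷-≡ c (embed π a) (embed π b)) (diffCount-embed π a b)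
  diffCount-embed (free ∷ π)    (x ∷ a) (y ∷ b) with x Bool.≟ y
  ... | yes _ = diffCount-embed π a b
  ... | no  _ = cong suc (diffCount-embed π a b)

  fits-injective : ∀ e e′ → (∀ c → Fits e c → Fits e′ c) → (∀ c → Fits e′ c → Fits e c) →
                   e ≡ e′
  fits-injective (fixed b) (fixed c) to from = cong fixed (to b refl)
  fits-injective (fixed b) free      to from = contradiction (from (not b) tt) (not-≢ b)
  fits-injective free      (fixed c) to from = contradiction (to (not c) tt) (not-≢ c)
  fits-injective free      free      to from = refl

  matches-injective : ∀ {n} (π σ : Pattern n) →
                      (∀ v → Matches π v → Matches σ v) → (∀ v → Matches σ v → Matches π v) →
                      π ≡ σ
  matches-injective []      []      to from = refl
  matches-injective (e ∷ π) (e′ ∷ σ) to from = cong₂ _∷_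
    (fits-injective e e′ (λ c x → Pointwise.head (to (c ∷ _) (x ∷ matches-embed π (replicate _ false))))
                         (λ c x → Pointwise.head (from (c ∷ _) (x ∷ matches-embed σ (replicate _ false)))))
    (matches-injective π σ (λ v m → Pointwise.tail (to (_ ∷ v) (proj₂ (fitting e) ∷ m)))
                           (λ v m → Pointwise.tail (from (_ ∷ v) (proj₂ (fitting e′) ∷ m))))

  subcube-injective : ∀ {n} (π σ : Pattern n) → subcube π ≗ᵥ subcube σ → π ≡ σ
  subcube-injective π σ same = matches-injective π σ
    (λ v m → Equivalence.to subcube⇔ (trans (sym (same v)) (Equivalence.from subcube⇔ m)))
    (λ v m → Equivalence.to subcube⇔ (trans (same v) (Equivalence.from subcube⇔ m)))

  UpSet : ∀ {n} → (Fin n → Fin n → Set) → Subset n → Set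
  UpSet R v = ∀ a b → Star R a b → a Subset.∈ v → b Subset.∈ v

  UpSetPattern : ∀ {n} → (Fin n → Fin n → Set) → Pattern n → Set
  UpSetPattern R π = ∀ v → Matches π v → UpSet R v

  Compatible : Entry → Entry → Set
  Compatible lower upper = ¬ (Fits lower true × Fits upper false)

  Closed : ∀ {n} → (Fin n → Fin n → Set) → Pattern n → Set
  Closed R π = ∀ a b → R a b → Compatible (lookup π a) (lookup π b)

  Releasable : ∀ {n} → (Fin n → Fin n → Set) → Pattern n → Fin n → Set
  Releasable R π p = (∀ a → R a p → ¬ Fits (lookup π a) true) ×
                     (∀ b → R p b → ¬ Fits (lookup π b) false)

  someVertex : ∀ {n} → Pattern n → Vec Bool n
  someVertex = Vec.map (proj₁ ∘ fitting)

  matches-someVertex : ∀ {n} (π : Pattern n) → Matches π (someVertex π)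
  matches-someVertex []      = []
  matches-someVertex (e ∷ π) = proj₂ (fitting e) ∷ matches-someVertex π

  matches-update : ∀ {n} (π : Pattern n) v i {c} →
                   Matches π v → Fits (lookup π i) c → Matches π (v [ i ]≔ c)
  matches-update (e ∷ π) (b ∷ v) zero    (_ ∷ m) x = x ∷ m
  matches-update (e ∷ π) (b ∷ v) (suc i) (y ∷ m) x = y ∷ matches-update π v i m x

  module _ {n} {R : Fin n → Fin n → Set} where

    closed-upSets : ∀ {π} → Closed R π → UpSetPattern R π
    closed-upSets {π} closed v m a b path a∈v = lookup⇒[]= b v (climb path ([]=⇒lookup a∈v))
      where
      climb : ∀ {a b} → Star R a b → lookup v a ≡ true → lookup v b ≡ true
      climb ε va = va
      climb {a} (_◅_ {j = a′} aRa′ rest) va with lookup v a′ in va′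
      ... | true  = climb rest va′
      ... | false = contradiction (subst (Fits _) va (Pointwise.lookup m a) ,
                                   subst (Fits _) va′ (Pointwise.lookup m a′)) (closed a a′ aRa′)

    -- A cover a ⋖ b violating compatibility is witnessed by a vertex with a set and b unset.
    upSets-closed : ∀ {π} → Irreflexive _≡_ R → UpSetPattern R π → Closed R π
    upSets-closed {π} irr upSets a b aRb (fa , fb) = contradiction b∈v′ b∉v′
      where
      a≢b : a ≢ b
      a≢b a≡b = irr a≡b aRb
      v v′ : Vec Bool n
      v  = someVertex π [ a ]≔ true
      v′ = v [ b ]≔ false
      m′ : Matches π v′
      m′ = matches-update π v b (matches-update π (someVertex π) a (matches-someVertex π) fa) fb
      b∈v′ : lookup v′ b ≡ true
      b∈v′ = []=⇒lookup (upSets v′ m′ a b (aRb ◅ ε)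
               (lookup⇒[]= a v′ (trans (lookup∘update′ a≢b v false) (lookup∘update a (someVertex π) true))))
      b∉v′ : lookup v′ b ≢ true
      b∉v′ e = not-≢ true (trans (sym (lookup∘update b v false)) e)

    release-closed : ∀ {π p} → Irreflexive _≡_ R →
                     Closed R π → Releasable R π p → Closed R (π [ p ]≔ free)
    release-closed {π} {p} irr closed (below , above) a b aRb with a ≟ p | b ≟ p
    ... | yes refl | yes refl = contradiction aRb (irr refl)
    ... | yes refl | no b≢p rewrite lookup∘update′ b≢p π free = λ (_ , fb) → above b aRb fb
    ... | no a≢p | yes refl rewrite lookup∘update′ a≢p π free = λ (fa , _) → below a aRb fa
    ... | no a≢p | no b≢p
      rewrite lookup∘update′ a≢p π free | lookup∘update′ b≢p π free = closed a b aRb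

    released-closed : ∀ {π p} → Irreflexive _≡_ R → Closed R (π [ p ]≔ free) → Releasable R π p
    released-closed {π} {p} irr closed = below , above
      where
      below : ∀ a → R a p → ¬ Fits (lookup π a) true
      below a aRp fa = closed a p aRp
        (subst (λ e → Fits e true) (sym (lookup∘update′ (λ a≡p → irr a≡p aRp) π free)) fa ,
         subst (λ e → Fits e false) (sym (lookup∘update p π free)) tt)
      above : ∀ b → R p b → ¬ Fits (lookup π b) false
      above b pRb fb = closed p b pRb
        (subst (λ e → Fits e true) (sym (lookup∘update p π free)) tt ,
         subst (λ e → Fits e false) (sym (lookup∘update′ (λ b≡p → irr (sym b≡p) pRb) π free)) fb)

    MaximalFor : Pattern n → Set
    MaximalFor π = UpSetPattern R π × (∀ p → lookup π p ≢ free → ¬ UpSetPattern R (π [ p ]≔ free))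

    LocallyMaximal : Pattern n → Set
    LocallyMaximal π = Closed R π × (∀ p → lookup π p ≢ free → ¬ Releasable R π p)

    maximal⇔locallyMaximal : ∀ {π} → Irreflexive _≡_ R → MaximalFor π ⇔ LocallyMaximal π
    maximal⇔locallyMaximal {π} irr = mk⇔
      (λ (upSets , maximal) → let closed = upSets-closed irr upSets in
         closed , λ p p-fixed rel → maximal p p-fixed (closed-upSets (release-closed {π} irr closed rel)))
      (λ (closed , maximal) → closed-upSets closed ,
         λ p p-fixed upSets → maximal p p-fixed (released-closed {π} irr (upSets-closed irr upSets)))

  EdgeEmbedding : ∀ {k n} → (Vec Bool k → Vec Bool n) → Set
  EdgeEmbedding f = Injective _≡_ _≡_ f × (∀ a i → Adj (f a) (f (toggle i a)))

  record SubcubeImage {k n} (f : Vec Bool k → Vec Bool n) : Set where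
    field
      shape          : Pattern n
      dimension      : freeCount shape ≡ k
      image-matches  : ∀ a → Matches shape (f a)
      matches-image  : ∀ v → Matches shape v → ∃ λ a → f a ≡ v
      direction      : Fin k → Fin n
      toggle-natural : ∀ a i → f (toggle i a) ≡ toggle (direction i) (f a)

  pointImage : ∀ {n} (f : Vec Bool 0 → Vec Bool n) → SubcubeImage f
  pointImage f = record
    { shape          = corner (f [])
    ; dimension      = freeCount-corner (f [])
    ; image-matches  = λ { [] → matches-corner (f []) }
    ; matches-image  = λ v m → [] , sym (matches-corner⁻ (f []) v m)
    ; direction      = λ ()
    ; toggle-natural = λ _ ()
    }

  lowerFacet : ∀ {k n} → (Vec Bool (suc k) → Vec Bool n) → Vec Bool k → Vec Bool n
  lowerFacet f a = f (false ∷ a)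

  lowerFacet-embedding : ∀ {k n} {f : Vec Bool (suc k) → Vec Bool n} →
                         EdgeEmbedding f → EdgeEmbedding (lowerFacet f)
  lowerFacet-embedding (inj , adj) = ∷-injectiveʳ ∘ inj , λ a i → adj (false ∷ a) (suc i)

  true∷≢false∷ : ∀ {k} {a b : Vec Bool k} → true ∷ a ≢ false ∷ b
  true∷≢false∷ ()

  -- The upper facet is the lower one translated along the edge at the origin:
  -- by induction over the lower facet, using that squares have only two diagonal corners.
  extendImage : ∀ {k n} (f : Vec Bool (suc k) → Vec Bool n) → EdgeEmbedding f →
                SubcubeImage (lowerFacet f) → SubcubeImage f
  extendImage {k} {n} f (inj , adj) L = record
    { shape          = L.shape [ p ]≔ free
    ; dimension      = trans (freeCount-release L.shape p p-fixed) (cong suc L.dimension)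
    ; image-matches  = image-matches
    ; matches-image  = matches-image
    ; direction      = direction
    ; toggle-natural = toggle-natural
    }
    where
    module L = SubcubeImage L
    lower upper : Vec Bool k → Vec Bool n
    lower a = f (false ∷ a)
    upper a = f (true ∷ a)
    origin : Vec Bool k
    origin = replicate k false

    originEdge : ∃ λ p → upper origin ≡ toggle p (lower origin)
    originEdge = Adj⇒toggle (lower origin) (upper origin) (adj (false ∷ origin) zero)

    p : Fin n
    p = proj₁ originEdge

    upper≡ : ∀ a → upper a ≡ toggle p (lower a)
    upper≡ = toggle-induction _ (proj₂ originEdge) step
      where
      step : ∀ a i → upper a ≡ toggle p (lower a) → upper (toggle i a) ≡ toggle p (lower (toggle i a))
      step a i ih with commonNeighbours p (L.direction i) (lower a) (upper (toggle i a)) p≢d adj₁ adj₂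
        where
        p≢d : p ≢ L.direction i
        p≢d p≡d = true∷≢false∷ (inj (trans ih (trans (cong (λ q → toggle q (lower a)) p≡d)
                                                       (sym (L.toggle-natural a i)))))
        adj₁ : Adj (toggle p (lower a)) (upper (toggle i a))
        adj₁ = subst (λ w → Adj w (upper (toggle i a))) ih (adj (true ∷ a) (suc i))
        adj₂ : Adj (toggle (L.direction i) (lower a)) (upper (toggle i a))
        adj₂ = subst (λ w → Adj w (upper (toggle i a))) (L.toggle-natural a i) (adj (false ∷ toggle i a) zero)
      ... | inj₁ e = contradiction (inj e) true∷≢false∷
      ... | inj₂ e = trans e (cong (toggle p) (sym (L.toggle-natural a i)))

    p-fixed : lookup L.shape p ≢ free
    p-fixed p-free with L.matches-image _ (matches-toggle L.shape p _ p-free (L.image-matches origin))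
    ... | a , e = true∷≢false∷ (inj (trans (upper≡ origin) (sym e)))

    image-matches : ∀ a → Matches (L.shape [ p ]≔ free) (f a)
    image-matches (false ∷ a) = matches-release L.shape p _ (L.image-matches a)
    image-matches (true ∷ a)  = subst (Matches _) (sym (upper≡ a))
                                  (matches-release-toggle L.shape p _ (L.image-matches a))

    matches-image : ∀ v → Matches (L.shape [ p ]≔ free) v → ∃ λ a → f a ≡ v
    matches-image v m with matches-release⁻ L.shape p v p-fixed m
    ... | inj₁ m₀ = Prod.map (false ∷_) (λ e → e) (L.matches-image v m₀)
    ... | inj₂ m₁ = let (a , e) = L.matches-image _ m₁ in
                    true ∷ a , trans (upper≡ a) (trans (cong (toggle p) e) (toggle-involutive p v))

    direction : Fin (suc k) → Fin n
    direction zero    = p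
    direction (suc i) = L.direction i

    toggle-natural : ∀ a i → f (toggle i a) ≡ toggle (direction i) (f a)
    toggle-natural (false ∷ a) zero    = upper≡ a
    toggle-natural (true ∷ a)  zero    =
      trans (sym (toggle-involutive p (lower a))) (cong (toggle p) (sym (upper≡ a)))
    toggle-natural (false ∷ a) (suc i) = L.toggle-natural a i
    toggle-natural (true ∷ a)  (suc i) = begin
      upper (toggle i a)                          ≡⟨ upper≡ (toggle i a) ⟩
      toggle p (lower (toggle i a))               ≡⟨ cong (toggle p) (L.toggle-natural a i) ⟩
      toggle p (toggle (L.direction i) (lower a)) ≡⟨ toggle-comm p (L.direction i) (lower a) ⟩
      toggle (L.direction i) (toggle p (lower a)) ≡⟨ cong (toggle (L.direction i)) (upper≡ a) ⟨
      toggle (L.direction i) (upper a)            ∎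
      where open ≡-Reasoning

  edgeEmbedding-image : ∀ {k n} (f : Vec Bool k → Vec Bool n) → EdgeEmbedding f → SubcubeImage f
  edgeEmbedding-image {zero}  f emb = pointImage f
  edgeEmbedding-image {suc k} f emb =
    extendImage f emb (edgeEmbedding-image (lowerFacet f) (lowerFacet-embedding emb))

  FilterPattern : ∀ {n} → Pattern n → Set
  FilterPattern {n} = UpSetPattern (CoverFin n)

  Maximal : ∀ {n} → Pattern n → Set
  Maximal {n} = MaximalFor {R = CoverFin n}

  subcube-cube : ∀ {n} (π : Pattern n) → FilterPattern π → IsCube n (freeCount π) (subcube π)
  subcube-cube {n} π filters = embed π , (filter , injective , adjacent) , image
    where
    filter : ∀ a → IsFilter n (embed π a)
    filter a = filters _ (matches-embed π a)
    injective : ∀ a b → embed π a ≡ embed π b → a ≡ b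
    injective a b e = trans (sym (project-embed π a)) (trans (cong (project π) e) (project-embed π b))
    adjacent : ∀ a b → Adj (embed π a) (embed π b) ⇔ Adj a b
    adjacent a b = mk⇔ (trans (sym (diffCount-embed π a b))) (trans (diffCount-embed π a b))
    image : ∀ v → (subcube π v ≡ true) ⇔ ∃ λ a → embed π a ≡ v
    image v = mk⇔ (λ e → project π v , embed-project π v (Equivalence.to subcube⇔ e))
                  (λ { (a , refl) → Equivalence.from subcube⇔ (matches-embed π a) })

  record CubePattern (n k : ℕ) (χ : Subset n → Bool) : Set where
    field
      shape     : Pattern n
      dimension : freeCount shape ≡ k
      filters   : FilterPattern shape
      spans     : χ ≗ᵥ subcube shape

  cube-pattern : ∀ {n k χ} → IsCube n k χ → CubePattern n k χ
  cube-pattern {n} {k} {χ} (f , (filter , injective , adjacent) , image) = record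
    { shape     = R.shape
    ; dimension = R.dimension
    ; filters   = λ v m → let (a , e) = R.matches-image v m in subst (IsFilter n) e (filter a)
    ; spans     = λ v → ⇔→≡ (mk⇔ (Equivalence.from subcube⇔ ∘ to-matches v)
                                  (from-matches v ∘ Equivalence.to subcube⇔))
    }
    where
    R : SubcubeImage f
    R = edgeEmbedding-image f ((λ {a} {b} → injective a b) ,
                               (λ a i → Equivalence.from (adjacent a (toggle i a)) (Adj-toggle i a)))
    module R = SubcubeImage R
    to-matches : ∀ v → χ v ≡ true → Matches R.shape v
    to-matches v e = let (a , fa≡v) = Equivalence.to (image v) e in
                     subst (Matches R.shape) fa≡v (R.image-matches a)
    from-matches : ∀ v → Matches R.shape v → χ v ≡ true
    from-matches v m = Equivalence.from (image v) (R.matches-image v m)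

  more-free-coordinate : ∀ {n} (π σ : Pattern n) → freeCount π < freeCount σ →
                         ∃ λ p → lookup σ p ≡ free × lookup π p ≢ free
  more-free-coordinate (fixed _ ∷ π) (free ∷ σ)    _       = zero , refl , λ ()
  more-free-coordinate (free ∷ π)    (free ∷ σ)    (s≤s lt) =
    Prod.map suc id (more-free-coordinate π σ lt)
  more-free-coordinate (free ∷ π)    (fixed _ ∷ σ) lt      =
    Prod.map suc id (more-free-coordinate π σ (<-trans (n<1+n _) lt))
  more-free-coordinate (fixed _ ∷ π) (fixed _ ∷ σ) lt      =
    Prod.map suc id (more-free-coordinate π σ lt)

  maximal-maxCube : ∀ {n} (π : Pattern n) → Maximal π → IsMaxCube n (freeCount π) (subcube π)
  maximal-maxCube {n} π (filters , maximal) = subcube-cube π filters , not-contained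
    where
    -- A larger cube containing the subcube of π frees some coordinate p fixed by π,
    -- so releasing p in π stays inside that cube, hence inside the filters.
    not-contained : ∀ j ψ → freeCount π < j → IsCube n j ψ → ¬ (subcube π ⊆ᵥ ψ)
    not-contained j ψ lt cube sub =
      let (p , C-p-free , π-p-fixed) = more-free-coordinate π C.shape (subst (freeCount π <_) (sym C.dimension) lt)
      in maximal p π-p-fixed (released-filters p C-p-free π-p-fixed)
      where
      module C = CubePattern (cube-pattern cube)
      inside : ∀ v → Matches π v → Matches C.shape v
      inside v m = Equivalence.to subcube⇔ (trans (sym (C.spans v)) (sub v (Equivalence.from subcube⇔ m)))
      released-filters : ∀ p → lookup C.shape p ≡ free → lookup π p ≢ free →
                         FilterPattern (π [ p ]≔ free)
      released-filters p C-p-free π-p-fixed v m with matches-release⁻ π p v π-p-fixed m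
      ... | inj₁ m₀ = C.filters v (inside v m₀)
      ... | inj₂ m₁ = C.filters v (subst (Matches C.shape) (toggle-involutive p v)
                                    (matches-toggle C.shape p _ C-p-free (inside _ m₁)))

  maxCube-maximal : ∀ {n k χ} → IsMaxCube n k χ →
                    ∃ λ π → freeCount π ≡ k × Maximal π × χ ≗ᵥ subcube π
  maxCube-maximal {n} {k} {χ} (cube , maximal) = C.shape , C.dimension , (C.filters , release-fails) , C.spans
    where
    module C = CubePattern (cube-pattern cube)
    release-fails : ∀ p → lookup C.shape p ≢ free → ¬ FilterPattern (C.shape [ p ]≔ free)
    release-fails p p-fixed filters =
      maximal (suc k) (subcube (C.shape [ p ]≔ free)) ≤-refl
        (subst (λ j → IsCube n j (subcube (C.shape [ p ]≔ free)))
               (trans (freeCount-release C.shape p p-fixed) (cong suc C.dimension))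
               (subcube-cube _ filters))
        (λ v e → Equivalence.from subcube⇔ (matches-release C.shape p v
                   (Equivalence.to subcube⇔ (trans (sym (C.spans v)) e))))

  -- Positions are 0-based: the ℕ-index u stands for the element x_{u+1} of the paper.
  _⋖_ : ℕ → ℕ → Set
  u ⋖ v = Cover (suc u) (suc v)

  data FenceCover : ℕ → ℕ → Set where
    mid⋖top      : FenceCover 1 0
    bottom⋖mid   : FenceCover 2 1
    mid⋖peak     : FenceCover 1 3
    valley⋖left  : ∀ j → FenceCover (4 + (j + j)) (3 + (j + j))
    valley⋖right : ∀ j → FenceCover (4 + (j + j)) (5 + (j + j))

  fenceCover-⋖ : ∀ {u v} → FenceCover u v → u ⋖ v
  fenceCover-⋖ mid⋖top          = c21
  fenceCover-⋖ bottom⋖mid       = c32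
  fenceCover-⋖ mid⋖peak         = c24
  fenceCover-⋖ (valley⋖left zero)    = c54
  fenceCover-⋖ (valley⋖left (suc j)) =
    subst₂ Cover (eq₁ j) (eq₂ j) (cOdd₊ (3 + j) (s≤s (s≤s (s≤s z≤n))))
    where
    eq₁ : ∀ j → 2 * (3 + j) + 1 ≡ 5 + (suc j + suc j)
    eq₁ = solve-∀
    eq₂ : ∀ j → 2 * (3 + j) ≡ 4 + (suc j + suc j)
    eq₂ = solve-∀
  fenceCover-⋖ (valley⋖right j) =
    subst₂ Cover (cong (_∸ 1) (eq j)) (eq j) (cOdd₋ (3 + j) (s≤s (s≤s (s≤s z≤n))))
    where
    eq : ∀ j → 2 * (3 + j) ≡ 6 + (j + j)
    eq = solve-∀

  ⋖-fenceCover : ∀ {u v} → u ⋖ v → FenceCover u v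
  ⋖-fenceCover c = normalise c refl refl
    where
    eq : ∀ j → 6 + (j + j) ≡ 2 * (3 + j)
    eq = solve-∀
    eq′ : ∀ j → 5 + (suc j + suc j) ≡ 2 * (3 + j) + 1
    eq′ = solve-∀
    eq″ : ∀ j → 4 + (suc j + suc j) ≡ 2 * (3 + j)
    eq″ = solve-∀
    normalise : ∀ {x y u v} → Cover x y → x ≡ suc u → y ≡ suc v → FenceCover u v
    normalise c21 refl refl = mid⋖top
    normalise c32 refl refl = bottom⋖mid
    normalise c24 refl refl = mid⋖peak
    normalise c54 refl refl = valley⋖left 0
    normalise (cOdd₋ (suc (suc (suc j))) (s≤s (s≤s (s≤s z≤n)))) x≡ y≡ =
      subst₂ FenceCover (suc-injective (trans (cong (_∸ 1) (eq j)) x≡)) (suc-injective (trans (eq j) y≡))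
             (valley⋖right j)
    normalise (cOdd₊ (suc (suc (suc j))) (s≤s (s≤s (s≤s z≤n)))) x≡ y≡ =
      subst₂ FenceCover (suc-injective (trans (eq′ j) x≡)) (suc-injective (trans (eq″ j) y≡))
             (valley⋖left (suc j))

  fenceCover-irrefl : ∀ {u v} → FenceCover u v → u ≢ v
  fenceCover-irrefl mid⋖top          ()
  fenceCover-irrefl bottom⋖mid       ()
  fenceCover-irrefl mid⋖peak         ()
  fenceCover-irrefl (valley⋖left j)  = 1+n≢n
  fenceCover-irrefl (valley⋖right j) = 1+n≢n ∘ sym

  alternate : Bool → ℕ → Bool
  alternate o zero    = o
  alternate o (suc t) = alternate (not o) t

  -- Position 3 + t (the element x_{4+t}) is a peak of the zigzag part iff t is even.
  peak : ℕ → Bool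
  peak = alternate true

  alternate-even : ∀ o j → alternate o (j + j) ≡ o
  alternate-even o zero    = refl
  alternate-even o (suc j) rewrite +-suc j j = trans (alternate-even (not (not o)) j) (not-involutive o)

  alternate-odd : ∀ o j → alternate o (suc (j + j)) ≡ not o
  alternate-odd o = alternate-even (not o)

  even-or-odd : ∀ t → ∃ λ j → t ≡ j + j ⊎ t ≡ suc (j + j)
  even-or-odd zero    = 0 , inj₁ refl
  even-or-odd (suc t) with even-or-odd t
  ... | j , inj₁ refl = j , inj₂ refl
  ... | j , inj₂ refl = suc j , inj₁ (cong suc (sym (+-suc j j)))

  leftNeighbour : ℕ → ℕ
  leftNeighbour zero    = 1
  leftNeighbour (suc t) = 3 + t

  below above : ℕ → List ℕ
  below 0                   = 1 ∷ []
  below 1                   = 2 ∷ []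
  below 2                   = []
  below (suc (suc (suc t))) = if peak t then leftNeighbour t ∷ 4 + t ∷ [] else []
  above 0                   = []
  above 1                   = 0 ∷ 3 ∷ []
  above 2                   = 1 ∷ []
  above (suc (suc (suc t))) = if peak t then [] else leftNeighbour t ∷ 4 + t ∷ []

  below-complete : ∀ {a p} → FenceCover a p → a ∈ below p
  below-complete mid⋖top          = here refl
  below-complete bottom⋖mid       = here refl
  below-complete mid⋖peak         = here refl
  below-complete (valley⋖left j)  rewrite alternate-even true j = there (here refl)
  below-complete (valley⋖right j) rewrite alternate-even true j = here refl

  above-complete : ∀ {p b} → FenceCover p b → b ∈ above p
  above-complete mid⋖top          = here refl
  above-complete bottom⋖mid       = here refl
  above-complete mid⋖peak         = there (here refl)
  above-complete (valley⋖left j)  rewrite alternate-odd true j = here refl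
  above-complete (valley⋖right j) rewrite alternate-odd true j = there (here refl)

  below-sound : ∀ {a} p → a ∈ below p → FenceCover a p
  below-sound 0 (here refl) = mid⋖top
  below-sound 1 (here refl) = bottom⋖mid
  below-sound (suc (suc (suc t))) a∈ with even-or-odd t
  ... | j , inj₂ refl rewrite alternate-odd true j = contradiction a∈ λ ()
  ... | j , inj₁ refl rewrite alternate-even true j = peak-sound j a∈
    where
    peak-sound : ∀ {a} j → a ∈ leftNeighbour (j + j) ∷ 4 + (j + j) ∷ [] → FenceCover a (3 + (j + j))
    peak-sound zero    (here refl) = mid⋖peak
    peak-sound (suc j) (here refl) rewrite +-suc j j = valley⋖right j
    peak-sound j       (there (here refl)) = valley⋖left j

  above-sound : ∀ {b} p → b ∈ above p → FenceCover p b
  above-sound 1 (here refl)         = mid⋖top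
  above-sound 1 (there (here refl)) = mid⋖peak
  above-sound 2 (here refl)         = bottom⋖mid
  above-sound (suc (suc (suc t))) b∈ with even-or-odd t
  ... | j , inj₁ refl rewrite alternate-even true j = contradiction b∈ λ ()
  ... | j , inj₂ refl rewrite alternate-odd true j = valley-sound b∈
    where
    valley-sound : ∀ {b} → b ∈ leftNeighbour (suc (j + j)) ∷ 4 + suc (j + j) ∷ [] → FenceCover (4 + (j + j)) b
    valley-sound (here refl)         = valley⋖left j
    valley-sound (there (here refl)) rewrite sym (+-suc 4 (j + j)) = valley⋖right j

  entryAt : ∀ {n} → Pattern n → ℕ → Maybe Entry
  entryAt []      _       = nothing
  entryAt (e ∷ π) zero    = just e
  entryAt (e ∷ π) (suc i) = entryAt π i

  entryAt-lookup : ∀ {n} (π : Pattern n) a → entryAt π (toℕ a) ≡ just (lookup π a)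
  entryAt-lookup (e ∷ π) zero    = refl
  entryAt-lookup (e ∷ π) (suc a) = entryAt-lookup π a

  entryAt-just : ∀ {n} (π : Pattern n) x {e} → entryAt π x ≡ just e →
                 ∃ λ a → toℕ a ≡ x × lookup π a ≡ e
  entryAt-just (e ∷ π) zero    refl = zero , refl , refl
  entryAt-just (e ∷ π) (suc x) eq   = Prod.map suc (Prod.map (cong suc) id) (entryAt-just π x eq)

  canBe : Bool → Maybe Entry → Bool
  canBe c (just e) = isYes (fits? e c)
  canBe c nothing  = false

  canBe-sound : ∀ {c e} → T (canBe c (just e)) → Fits e c
  canBe-sound {c} {e} = toWitness {a? = fits? e c}

  canBe-complete : ∀ {c e} → Fits e c → T (canBe c (just e))
  canBe-complete {c} {e} = fromWitness {a? = fits? e c}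

  compatible : Maybe Entry → Maybe Entry → Bool
  compatible lower upper = not (canBe true lower ∧ canBe false upper)

  compatible-sound : ∀ {e f} → T (compatible (just e) (just f)) → Compatible e f
  compatible-sound {e} {f} ok (fe , ff) with canBe true (just e) in ce | canBe false (just f) in cf
  ... | true  | true  = ok
  ... | false | _     = subst T ce (canBe-complete fe)
  ... | true  | false = subst T cf (canBe-complete ff)

  compatible-complete : ∀ {e f} → Compatible e f → T (compatible (just e) (just f))
  compatible-complete {e} {f} incompatible with canBe true (just e) in ce | canBe false (just f) in cf
  ... | true  | true  = incompatible (canBe-sound (subst T (sym ce) tt) , canBe-sound (subst T (sym cf) tt))
  ... | false | _     = tt
  ... | true  | false = tt

  isFree : Entry → Bool
  isFree (fixed _) = false
  isFree free      = true

  isFree-sound : ∀ {e} → T (isFree e) → e ≡ free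
  isFree-sound {free} _ = refl

  -- Compatibility with the neighbours in the Hasse diagram, and, for a fixed entry,
  -- a neighbour that prevents releasing it.
  localCondition : List (Maybe Entry) → Entry → List (Maybe Entry) → Bool
  localCondition lower e upper =
    all (λ l → compatible l (just e)) lower ∧ all (compatible (just e)) upper ∧
    (isFree e ∨ any (canBe true) lower ∨ any (canBe false) upper)

  lowerEntries upperEntries : ∀ {n} → Pattern n → ℕ → List (Maybe Entry)
  lowerEntries π p = List.map (entryAt π) (below p)
  upperEntries π p = List.map (entryAt π) (above p)

  Good : ∀ {n} → Pattern n → Set
  Good π = ∀ p {e} → entryAt π p ≡ just e → T (localCondition (lowerEntries π p) e (upperEntries π p))

  CoverFin-irrefl : ∀ {n} → Irreflexive _≡_ (CoverFin n)
  CoverFin-irrefl refl c = fenceCover-irrefl (⋖-fenceCover c) refl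

  canBe-entryAt : ∀ {n} (π : Pattern n) x {c} → T (canBe c (entryAt π x)) →
                  ∃ λ a → toℕ a ≡ x × Fits (lookup π a) c
  canBe-entryAt π x {c} can with entryAt π x in eq
  canBe-entryAt π x {c} () | nothing
  ... | just e = let (a , a≡x , la) = entryAt-just π x eq in
                 a , a≡x , subst (λ e → Fits e c) (sym la) (canBe-sound can)

  canBe-lookup : ∀ {n} (π : Pattern n) a {c} → Fits (lookup π a) c → T (canBe c (entryAt π (toℕ a)))
  canBe-lookup π a {c} fits = subst (T ∘ canBe c) (sym (entryAt-lookup π a)) (canBe-complete fits)

  compatible-entryAt : ∀ {n} (π : Pattern n) x e →
                       (∀ a → toℕ a ≡ x → Compatible (lookup π a) e) → T (compatible (entryAt π x) (just e))
  compatible-entryAt π x e compat with entryAt π x in eq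
  ... | nothing = tt
  ... | just d  = let (a , a≡x , la) = entryAt-just π x eq in
                  compatible-complete (subst (λ d → Compatible d e) la (compat a a≡x))

  compatible-entryAt′ : ∀ {n} (π : Pattern n) e x →
                        (∀ b → toℕ b ≡ x → Compatible e (lookup π b)) → T (compatible (just e) (entryAt π x))
  compatible-entryAt′ π e x compat with entryAt π x in eq
  ... | nothing = subst T (cong not (sym (∧-zeroʳ (canBe true (just e))))) tt
  ... | just d  = let (b , b≡x , lb) = entryAt-just π x eq in
                  compatible-complete (subst (Compatible e) lb (compat b b≡x))

  localCondition⇔ : ∀ {lower e upper} → T (localCondition lower e upper) ⇔
                    (All (λ l → T (compatible l (just e))) lower × All (T ∘ compatible (just e)) upper ×
                     (T (isFree e) ⊎ Any (T ∘ canBe true) lower ⊎ Any (T ∘ canBe false) upper))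
  localCondition⇔ {lower} {e} {upper} = mk⇔
    (λ ok → let (lowerOK , rest) = Equivalence.to T-∧ ok
                (upperOK , blocked) = Equivalence.to T-∧ rest
            in All.all⁺ _ lower lowerOK , All.all⁺ _ upper upperOK ,
               Data.Sum.map₂ (Data.Sum.map (Any.any⁻ _ lower) (Any.any⁻ _ upper) ∘ Equivalence.to T-∨)
                             (Equivalence.to T-∨ blocked))
    (λ (lowerOK , upperOK , blocked) →
       Equivalence.from T-∧ (All.all⁻ _ lowerOK , Equivalence.from T-∧ (All.all⁻ _ upperOK ,
         Equivalence.from T-∨ (Data.Sum.map₂ (Equivalence.from T-∨ ∘ Data.Sum.map (Any.any⁺ _) (Any.any⁺ _))
                                             blocked))))

  module _ {n} (π : Pattern n) where

    lowerWitness : ∀ p {c} → Any (T ∘ canBe c) (lowerEntries π (toℕ p)) →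
                   ∃ λ a → CoverFin n a p × Fits (lookup π a) c
    lowerWitness p some with find (Any.map⁻ some)
    ... | x , x∈ , can with canBe-entryAt π x can
    ...   | a , refl , fa = a , fenceCover-⋖ (below-sound (toℕ p) x∈) , fa

    upperWitness : ∀ p {c} → Any (T ∘ canBe c) (upperEntries π (toℕ p)) →
                   ∃ λ b → CoverFin n p b × Fits (lookup π b) c
    upperWitness p some with find (Any.map⁻ some)
    ... | x , x∈ , can with canBe-entryAt π x can
    ...   | b , refl , fb = b , fenceCover-⋖ (above-sound (toℕ p) x∈) , fb

    good⇒locallyMaximal : Good π → LocallyMaximal {R = CoverFin n} π
    good⇒locallyMaximal good = closed , unreleasable
      where
      unfolded : ∀ p → All (λ l → T (compatible l (just (lookup π p)))) (lowerEntries π (toℕ p)) ×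
                       All (T ∘ compatible (just (lookup π p))) (upperEntries π (toℕ p)) ×
                       (T (isFree (lookup π p)) ⊎ Any (T ∘ canBe true) (lowerEntries π (toℕ p))
                                                ⊎ Any (T ∘ canBe false) (upperEntries π (toℕ p)))
      unfolded p = Equivalence.to localCondition⇔ (good (toℕ p) (entryAt-lookup π p))

      closed : Closed (CoverFin n) π
      closed a b c = compatible-sound (subst (λ m → T (compatible m (just (lookup π b)))) (entryAt-lookup π a)
                       (All.lookup (All.map⁻ (proj₁ (unfolded b))) (below-complete (⋖-fenceCover c))))

      unreleasable : ∀ p → lookup π p ≢ free → ¬ Releasable (CoverFin n) π p
      unreleasable p p-fixed (lowerFalse , upperTrue) with proj₂ (proj₂ (unfolded p))
      ... | inj₁ isFree-p = p-fixed (isFree-sound isFree-p)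
      ... | inj₂ (inj₁ someLower) = let (a , c , fa) = lowerWitness p someLower in lowerFalse a c fa
      ... | inj₂ (inj₂ someUpper) = let (b , c , fb) = upperWitness p someUpper in upperTrue b c fb

    locallyMaximal⇒good : LocallyMaximal {R = CoverFin n} π → Good π
    locallyMaximal⇒good (closed , unreleasable) p eq with entryAt-just π p eq
    ... | q , refl , refl = Equivalence.from localCondition⇔ (All.map⁺ lowerOK , All.map⁺ upperOK , blocked)
      where
      e : Entry
      e = lookup π q
      lowerOK : All (λ x → T (compatible (entryAt π x) (just e))) (below (toℕ q))
      lowerOK = All.tabulate λ {x} x∈ →
        compatible-entryAt π x e λ { a refl → closed a q (fenceCover-⋖ (below-sound (toℕ q) x∈)) }
      upperOK : All (λ x → T (compatible (just e) (entryAt π x))) (above (toℕ q))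
      upperOK = All.tabulate λ {x} x∈ →
        compatible-entryAt′ π e x λ { b refl → closed q b (fenceCover-⋖ (above-sound (toℕ q) x∈)) }
      blocked : T (isFree e) ⊎ Any (T ∘ canBe true) (lowerEntries π (toℕ q))
                             ⊎ Any (T ∘ canBe false) (upperEntries π (toℕ q))
      blocked with T? (isFree e) | Any.any? (T? ∘ canBe true) (lowerEntries π (toℕ q))
                                 | Any.any? (T? ∘ canBe false) (upperEntries π (toℕ q))
      ... | yes isFree-e | _          | _          = inj₁ isFree-e
      ... | no _         | yes lower  | _          = inj₂ (inj₁ lower)
      ... | no _         | no _       | yes upper  = inj₂ (inj₂ upper)
      ... | no ¬isFree-e | no ¬lower  | no ¬upper  =
        contradiction (lowerFalse , upperTrue) (unreleasable q e-fixed)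
        where
        e-fixed : e ≢ free
        e-fixed e≡free = ¬isFree-e (subst (T ∘ isFree) (sym e≡free) tt)
        lowerFalse : ∀ a → CoverFin n a q → ¬ Fits (lookup π a) true
        lowerFalse a c fa = ¬lower (Any.map⁺ (lose (below-complete (⋖-fenceCover c)) (canBe-lookup π a fa)))
        upperTrue : ∀ b → CoverFin n q b → ¬ Fits (lookup π b) false
        upperTrue b c fb = ¬upper (Any.map⁺ (lose (above-complete (⋖-fenceCover c)) (canBe-lookup π b fb)))

    maximal⇔good : Maximal π ⇔ Good π
    maximal⇔good = mk⇔
      (locallyMaximal⇒good ∘ Equivalence.to (maximal⇔locallyMaximal CoverFin-irrefl))
      (Equivalence.from (maximal⇔locallyMaximal CoverFin-irrefl) ∘ good⇒locallyMaximal)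

  -- The flag says whether the position is a peak (both zigzag neighbours below it) or a valley.
  tailCondition : Bool → Maybe Entry → Entry → Maybe Entry → Bool
  tailCondition true  l e r = localCondition (l ∷ r ∷ []) e []
  tailCondition false l e r = localCondition [] e (l ∷ r ∷ [])

  localCondition-zigzag : ∀ {n} (π : Pattern n) t e →
    localCondition (lowerEntries π (3 + t)) e (upperEntries π (3 + t))
      ≡ tailCondition (peak t) (entryAt π (leftNeighbour t)) e (entryAt π (4 + t))
  localCondition-zigzag π t e with peak t
  ... | true  = refl
  ... | false = refl

  tailOK : ∀ {m} → Bool → Maybe Entry → Pattern m → Bool
  tailOK o l []      = true
  tailOK o l (e ∷ w) = tailCondition o l e (entryAt w 0) ∧ tailOK (not o) (just e) w

  leftOf : ∀ {m} → Maybe Entry → Pattern m → ℕ → Maybe Entry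
  leftOf l w zero    = l
  leftOf l w (suc t) = entryAt w t

  leftOf-∷ : ∀ {m} l e (w : Pattern m) t → leftOf l (e ∷ w) (suc t) ≡ leftOf (just e) w t
  leftOf-∷ l e w zero    = refl
  leftOf-∷ l e w (suc t) = refl

  TailGood : ∀ {m} → Bool → Maybe Entry → Pattern m → Set
  TailGood o l w = ∀ t {e} → entryAt w t ≡ just e →
                   T (tailCondition (alternate o t) (leftOf l w t) e (entryAt w (suc t)))

  tailOK⇔ : ∀ {m} o l (w : Pattern m) → T (tailOK o l w) ⇔ TailGood o l w
  tailOK⇔ o l w = mk⇔ (to o l w) (from o l w)
    where
    to : ∀ {m} o l (w : Pattern m) → T (tailOK o l w) → TailGood o l w
    to o l (e ∷ w) ok zero    refl = proj₁ (Equivalence.to T-∧ ok)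
    to o l (e ∷ w) ok (suc t) eq   =
      subst (λ l′ → T (tailCondition (alternate (not o) t) l′ _ (entryAt w (suc t)))) (sym (leftOf-∷ l e w t))
            (to (not o) (just e) w (proj₂ (Equivalence.to T-∧ ok)) t eq)
    from : ∀ {m} o l (w : Pattern m) → TailGood o l w → T (tailOK o l w)
    from o l []      good = tt
    from o l (e ∷ w) good = Equivalence.from T-∧ (good zero refl , from (not o) (just e) w λ t eq →
      subst (λ l′ → T (tailCondition (alternate (not o) t) l′ _ (entryAt w (suc t)))) (leftOf-∷ l e w t)
            (good (suc t) eq))

  headCondition : Entry → Entry → Entry → Maybe Entry → Bool
  headCondition c₀ c₁ c₂ r = localCondition (just c₁ ∷ []) c₀ []
                           ∧ localCondition [] c₂ (just c₁ ∷ [])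
                           ∧ localCondition (just c₂ ∷ []) c₁ (just c₀ ∷ r ∷ [])

  good⇔head×tail : ∀ {m} c₀ c₁ c₂ (w : Pattern m) →
             Good (c₀ ∷ c₁ ∷ c₂ ∷ w) ⇔
             (T (headCondition c₀ c₁ c₂ (entryAt w 0)) × T (tailOK true (just c₁) w))
  good⇔head×tail {m} c₀ c₁ c₂ w = mk⇔
    (λ good → Equivalence.from (T-∧ {top}) (good 0 refl ,
                Equivalence.from (T-∧ {bottom}) (good 2 refl , good 1 refl)) ,
              Equivalence.from (tailOK⇔ true (just c₁) w) λ t eq →
                subst (λ l → T (tailCondition (peak t) l _ (entryAt w (suc t)))) (leftNeighbour≡ t)
                      (subst T (localCondition-zigzag π t _) (good (3 + t) eq)))
    (λ (head , tail) → let (top-ok , rest) = Equivalence.to (T-∧ {top}) head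
                           (bottom-ok , mid-ok) = Equivalence.to (T-∧ {bottom}) rest in λ where
       0 refl → top-ok
       1 refl → mid-ok
       2 refl → bottom-ok
       (suc (suc (suc t))) eq →
         subst T (sym (localCondition-zigzag π t _))
           (subst (λ l → T (tailCondition (peak t) l _ (entryAt w (suc t)))) (sym (leftNeighbour≡ t))
                  (Equivalence.to (tailOK⇔ true (just c₁) w) tail t eq)))
    where
    π : Pattern (3 + m)
    π = c₀ ∷ c₁ ∷ c₂ ∷ w
    top bottom : Bool
    top    = localCondition (just c₁ ∷ []) c₀ []
    bottom = localCondition [] c₂ (just c₁ ∷ [])
    leftNeighbour≡ : ∀ t → entryAt π (leftNeighbour t) ≡ leftOf (just c₁) w t
    leftNeighbour≡ zero    = refl
    leftNeighbour≡ (suc t) = refl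

  ¬fits⇒fixed : ∀ e c → ¬ Fits e c → e ≡ fixed (not c)
  ¬fits⇒fixed (fixed b) c ¬fits = cong fixed (¬-not (¬fits ∘ sym))
  ¬fits⇒fixed free      c ¬fits = contradiction tt ¬fits

  compatible-below-I : ∀ x → T (compatible x (just I))
  compatible-below-I nothing  = tt
  compatible-below-I (just e) = subst (T ∘ not) (sym (∧-zeroʳ (canBe true (just e)))) tt

  forced-step : ∀ o {l e r} → Fits l o → T (tailCondition o (just l) e r) → e ≡ fixed o
  forced-step true  {l} {e} {r} fits ok = ¬fits⇒fixed e false λ fe →
    compatible-sound (All.head (proj₁ (Equivalence.to (localCondition⇔ {just l ∷ r ∷ []} {e} {[]}) ok)))
                     (fits , fe)
  forced-step false {l} {e} {r} fits ok = ¬fits⇒fixed e true λ fe →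
    compatible-sound (All.head (proj₁ (proj₂ (Equivalence.to (localCondition⇔ {[]} {e} {just l ∷ r ∷ []}) ok))))
                     (fe , fits)

  forced-step-ok : ∀ o {l} r → Fits l o → T (tailCondition o (just l) (fixed o) r)
  forced-step-ok true  {l} r fits = Equivalence.from (localCondition⇔ {just l ∷ r ∷ []} {I} {[]})
    (compatible-below-I (just l) ∷ compatible-below-I r ∷ [] , [] , inj₂ (inj₁ (here (canBe-complete fits))))
  forced-step-ok false {l} r fits = Equivalence.from (localCondition⇔ {[]} {O} {just l ∷ r ∷ []})
    ([] , tt ∷ tt ∷ [] , inj₂ (inj₂ (here (canBe-complete fits))))

  data OpenStep (o : Bool) : Entry → Maybe Entry → Set where
    release : ∀ {r} → OpenStep o free r
    hold    : ∀ {x} → x ≢ fixed (not o) → OpenStep o (fixed o) (just x)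

  open-step : ∀ o {e r} → T (tailCondition o (just (fixed (not o))) e r) → OpenStep o e r
  open-step o     {free}              _  = release
  open-step true  {I} {just I}        _  = hold λ ()
  open-step true  {I} {just free}     _  = hold λ ()
  open-step false {O} {just O}        _  = hold λ ()
  open-step false {O} {just free}     _  = hold λ ()
  open-step true  {I} {nothing}       ()
  open-step true  {I} {just O}        ()
  open-step true  {O} {nothing}       ()
  open-step true  {O} {just O}        ()
  open-step true  {O} {just I}        ()
  open-step true  {O} {just free}     ()
  open-step false {O} {nothing}       ()
  open-step false {O} {just I}        ()
  open-step false {I} {nothing}       ()
  open-step false {I} {just O}        ()
  open-step false {I} {just I}        ()
  open-step false {I} {just free}     ()

  openStep-entry : ∀ {o e r} → OpenStep o e r → e ≡ free ⊎ e ≡ fixed o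
  openStep-entry release  = inj₁ refl
  openStep-entry (hold _) = inj₂ refl

  release-step-ok : ∀ o r → r ≡ nothing ⊎ r ≡ just (fixed (not o)) →
                    T (tailCondition o (just (fixed (not o))) free r)
  release-step-ok true  _ (inj₁ refl) = tt
  release-step-ok true  _ (inj₂ refl) = tt
  release-step-ok false _ (inj₁ refl) = tt
  release-step-ok false _ (inj₂ refl) = tt

  hold-step-ok : ∀ o → T (tailCondition o (just (fixed (not o))) (fixed o) (just free))
  hold-step-ok true  = tt
  hold-step-ok false = tt

  -- Accepted tails with m entries, k of them free, starting at a position of orientation o.
  -- In forcedTails the left neighbour can take the value o, which forces the entry to fixed o;
  -- in openTails it is fixed to not o, and the entry is free, or fixed o followed by a free entry.
  mutual
    forcedTails : Bool → (m : ℕ) → ℕ → List (Pattern m)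
    forcedTails o zero    zero    = [] ∷ []
    forcedTails o zero    (suc k) = []
    forcedTails o (suc m) k       = List.map (fixed o ∷_) (openTails (not o) m k)

    openTails : Bool → (m : ℕ) → ℕ → List (Pattern m)
    openTails o zero    zero    = [] ∷ []
    openTails o zero    (suc k) = []
    openTails o (suc m) zero    = []
    openTails o (suc m) (suc k) = List.map (free ∷_) (forcedTails (not o) m k) ++ holdTails o m k

    holdTails : Bool → (m : ℕ) → ℕ → List (Pattern (suc m))
    holdTails o zero    k = []
    holdTails o (suc m) k = List.map (λ w → fixed o ∷ free ∷ w) (forcedTails o m k)

  forcedTails-head : ∀ o m k {w} → w ∈ forcedTails o m k →
                     entryAt w 0 ≡ nothing ⊎ entryAt w 0 ≡ just (fixed o)
  forcedTails-head o zero    zero    (here refl) = inj₁ refl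
  forcedTails-head o (suc m) k       w∈ with ∈-map⁻ (fixed o ∷_) w∈
  ... | _ , _ , refl = inj₂ refl

  fixed-not-not : ∀ o → just (fixed o) ≡ just (fixed (not (not o)))
  fixed-not-not o = cong (just ∘ fixed) (sym (not-involutive o))

  mutual
    forcedTails-sound : ∀ o m k {l} {w} → Fits l o → w ∈ forcedTails o m k →
                        T (tailOK o (just l) w) × freeCount w ≡ k
    forcedTails-sound o zero    zero    fits (here refl) = tt , refl
    forcedTails-sound o (suc m) k       fits w∈ with ∈-map⁻ (fixed o ∷_) w∈
    ... | v , v∈ , refl =
      let (ok , count) = openTails-sound (not o) m k v∈ in
      Equivalence.from T-∧ (forced-step-ok o _ fits ,
                            subst (λ l → T (tailOK (not o) l v)) (sym (fixed-not-not o)) ok) ,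
      count

    openTails-sound : ∀ o m k {w} → w ∈ openTails o m k →
                      T (tailOK o (just (fixed (not o))) w) × freeCount w ≡ k
    openTails-sound o zero    zero    (here refl) = tt , refl
    openTails-sound o (suc m) (suc k) w∈ with ∈-++⁻ (List.map (free ∷_) (forcedTails (not o) m k)) w∈
    ... | inj₁ w∈₁ with ∈-map⁻ (free ∷_) w∈₁
    ...   | v , v∈ , refl =
      let (ok , count) = forcedTails-sound (not o) m k tt v∈ in
      Equivalence.from T-∧ (release-step-ok o _ (forcedTails-head (not o) m k v∈) , ok) , cong suc count
    openTails-sound o (suc (suc m)) (suc k) w∈ | inj₂ w∈₂ with ∈-map⁻ (λ w → fixed o ∷ free ∷ w) w∈₂
    ...   | v , v∈ , refl =
      let (ok , count) = forcedTails-sound o m k tt v∈ in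
      Equivalence.from T-∧ (hold-step-ok o , Equivalence.from T-∧
        (subst (λ l → T (tailCondition (not o) l free (entryAt v 0))) (sym (fixed-not-not o))
               (release-step-ok (not o) _
                  (Data.Sum.map₂ (λ e → trans e (fixed-not-not o)) (forcedTails-head o m k v∈))) ,
         subst (λ o′ → T (tailOK o′ (just free) v)) (sym (not-involutive o)) ok)) ,
      cong suc count

  mutual
    forcedTails-complete : ∀ o {m} l (w : Pattern m) → Fits l o → T (tailOK o (just l) w) →
                           w ∈ forcedTails o m (freeCount w)
    forcedTails-complete o l []      fits ok = here refl
    forcedTails-complete o l (e ∷ w) fits ok with forced-step o fits (proj₁ (Equivalence.to T-∧ ok))
    ... | refl = ∈-map⁺ (fixed o ∷_) (openTails-complete (not o) w
                   (subst (λ l → T (tailOK (not o) l w)) (fixed-not-not o) (proj₂ (Equivalence.to T-∧ ok))))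

    openTails-complete : ∀ o {m} (w : Pattern m) → T (tailOK o (just (fixed (not o))) w) →
                         w ∈ openTails o m (freeCount w)
    openTails-complete o []      ok = here refl
    openTails-complete o (e ∷ w) ok =
      fromStep (open-step o (proj₁ (Equivalence.to T-∧ ok))) (proj₂ (Equivalence.to T-∧ ok))
      where
      fromStep : ∀ {e m} {w : Pattern m} → OpenStep o e (entryAt w 0) → T (tailOK (not o) (just e) w) →
           (e ∷ w) ∈ openTails o (suc m) (freeCount (e ∷ w))
      fromStep {w = x ∷ w} (hold x≢) ok′ with openStep-entry (open-step (not o) x-ok)
        where
        x-ok : T (tailCondition (not o) (just (fixed (not (not o)))) x (entryAt w 0))
        x-ok = subst (λ l → T (tailCondition (not o) l x (entryAt w 0))) (fixed-not-not o)
                     (proj₁ (Equivalence.to T-∧ ok′))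
      ... | inj₁ refl = ∈-++⁺ʳ (List.map (free ∷_) (forcedTails (not o) _ _))
                          (∈-map⁺ (λ w → fixed o ∷ free ∷ w) (forcedTails-complete o free w tt
                            (subst (λ o′ → T (tailOK o′ (just free) w)) (not-involutive o)
                                   (proj₂ (Equivalence.to T-∧ ok′)))))
      ... | inj₂ refl = contradiction refl x≢
      fromStep release ok′ = ∈-++⁺ˡ (∈-map⁺ (free ∷_) (forcedTails-complete (not o) free _ tt ok′))

  free∉holdTails : ∀ {o} m {k v} → ¬ (free ∷ v ∈ holdTails o m k)
  free∉holdTails (suc m) w∈ with ∈-map⁻ _ w∈
  ... | _ , _ , ()

  mutual
    forcedTails-unique : ∀ o m k → Unique (forcedTails o m k)
    forcedTails-unique o zero    zero    = [] ∷ []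
    forcedTails-unique o zero    (suc k) = []
    forcedTails-unique o (suc m) k       = Unique.map⁺ ∷-injectiveʳ (openTails-unique (not o) m k)

    openTails-unique : ∀ o m k → Unique (openTails o m k)
    openTails-unique o zero    zero    = [] ∷ []
    openTails-unique o zero    (suc k) = []
    openTails-unique o (suc m) zero    = []
    openTails-unique o (suc m) (suc k) =
      Unique.++⁺ (Unique.map⁺ ∷-injectiveʳ (forcedTails-unique (not o) m k)) (holdTails-unique o m k) disjoint
      where
      disjoint : Disjoint (List.map (free ∷_) (forcedTails (not o) m k)) (holdTails o m k)
      disjoint (w∈₁ , w∈₂) with ∈-map⁻ (free ∷_) w∈₁
      ... | _ , _ , refl = free∉holdTails m w∈₂

    holdTails-unique : ∀ o m k → Unique (holdTails o m k)
    holdTails-unique o zero    k = []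
    holdTails-unique o (suc m) k = Unique.map⁺ (∷-injectiveʳ ∘ ∷-injectiveʳ) (forcedTails-unique o m k)

  data HeadShape : Entry → Entry → Entry → Set where
    x₃-free : HeadShape I I free
    x₂-free : HeadShape I free O
    x₁-free : HeadShape free O O

  head-shape : ∀ c₀ c₁ c₂ r → T (headCondition c₀ c₁ c₂ r) → HeadShape c₀ c₁ c₂
  head-shape I    I    free r _  = x₃-free
  head-shape I    free O    r _  = x₂-free
  head-shape free O    O    r _  = x₁-free
  head-shape O    O    c₂   r ()
  head-shape O    I    c₂   r ()
  head-shape O    free c₂   r ()
  head-shape I    O    c₂   r ()
  head-shape I    I    O    r ()
  head-shape I    I    I    r ()
  head-shape I    free I    r ()
  head-shape I    free free r ()
  head-shape free O    I    r ()
  head-shape free O    free r ()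
  head-shape free I    c₂   r ()
  head-shape free free c₂   r ()

  headCondition-forced : ∀ r → r ≡ nothing ⊎ r ≡ just I →
                         T (headCondition I I free r) × T (headCondition I free O r)
  headCondition-forced _ (inj₁ refl) = tt , tt
  headCondition-forced _ (inj₂ refl) = tt , tt

  headCondition-x₁-free : ∀ r → T (headCondition free O O r)
  headCondition-x₁-free nothing        = tt
  headCondition-x₁-free (just (fixed _)) = tt
  headCondition-x₁-free (just free)    = tt

  maximalPatterns : (n k : ℕ) → List (Pattern n)
  maximalPatterns 0 0             = [] ∷ []
  maximalPatterns 0 (suc k)       = []
  maximalPatterns 1 1             = (free ∷ []) ∷ []
  maximalPatterns 1 _             = []
  maximalPatterns 2 1             = (I ∷ free ∷ []) ∷ (free ∷ O ∷ []) ∷ []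
  maximalPatterns 2 _             = []
  maximalPatterns (suc (suc (suc m))) zero    = []
  maximalPatterns (suc (suc (suc m))) (suc k) =
    List.map (λ w → I ∷ I ∷ free ∷ w) (forcedTails true m k) ++
    List.map (λ w → I ∷ free ∷ O ∷ w) (forcedTails true m k) ++
    List.map (λ w → free ∷ O ∷ O ∷ w) (openTails true m k)

  maximalPatterns-sound : ∀ n k {π} → π ∈ maximalPatterns n k → Good π × freeCount π ≡ k
  maximalPatterns-sound 0 0 (here refl) = (λ _ ()) , refl
  maximalPatterns-sound 1 1 (here refl) = (λ { 0 refl → tt ; (suc _) () }) , refl
  maximalPatterns-sound 2 1 (here refl) = (λ { 0 refl → tt ; 1 refl → tt ; (suc (suc _)) () }) , refl
  maximalPatterns-sound 2 1 (there (here refl)) = (λ { 0 refl → tt ; 1 refl → tt ; (suc (suc _)) () }) , refl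
  maximalPatterns-sound (suc (suc (suc m))) (suc k) π∈
    with ∈-++⁻ (List.map (λ w → I ∷ I ∷ free ∷ w) (forcedTails true m k)) π∈
  ... | inj₁ π∈₁ with ∈-map⁻ (λ w → I ∷ I ∷ free ∷ w) π∈₁
  ...   | w , w∈ , refl = let (ok , count) = forcedTails-sound true m k refl w∈ in
    Equivalence.from (good⇔head×tail I I free w) (proj₁ (headCondition-forced _ (forcedTails-head true m k w∈)) , ok) ,
    cong suc count
  maximalPatterns-sound (suc (suc (suc m))) (suc k) π∈ | inj₂ π∈₂
    with ∈-++⁻ (List.map (λ w → I ∷ free ∷ O ∷ w) (forcedTails true m k)) π∈₂
  ... | inj₁ π∈₁ with ∈-map⁻ (λ w → I ∷ free ∷ O ∷ w) π∈₁
  ...   | w , w∈ , refl = let (ok , count) = forcedTails-sound true m k tt w∈ in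
    Equivalence.from (good⇔head×tail I free O w) (proj₂ (headCondition-forced _ (forcedTails-head true m k w∈)) , ok) ,
    cong suc count
  maximalPatterns-sound (suc (suc (suc m))) (suc k) π∈ | inj₂ π∈₂ | inj₂ π∈₃
    with ∈-map⁻ (λ w → free ∷ O ∷ O ∷ w) π∈₃
  ... | w , w∈ , refl = let (ok , count) = openTails-sound true m k w∈ in
    Equivalence.from (good⇔head×tail free O O w) (headCondition-x₁-free (entryAt w 0) , ok) , cong suc count

  good-singleton : ∀ c₀ → T (localCondition (nothing ∷ []) c₀ []) → c₀ ≡ free
  good-singleton free _ = refl

  good-pair : ∀ c₀ c₁ → T (localCondition (just c₁ ∷ []) c₀ []) →
              T (localCondition (nothing ∷ []) c₁ (just c₀ ∷ nothing ∷ [])) →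
              (c₀ ∷ c₁ ∷ []) ∈ maximalPatterns 2 (freeCount (c₀ ∷ c₁ ∷ []))
  good-pair I    free _ _ = here refl
  good-pair free O    _ _ = there (here refl)
  good-pair O    O    () _
  good-pair O    I    () _
  good-pair O    free () _
  good-pair I    O    () _
  good-pair I    I    _  ()
  good-pair free I    () _
  good-pair free free () _

  maximalPatterns-complete : ∀ {n} (π : Pattern n) → Good π → π ∈ maximalPatterns n (freeCount π)
  maximalPatterns-complete []             good = here refl
  maximalPatterns-complete (c₀ ∷ [])      good with good-singleton c₀ (good 0 refl)
  ... | refl = here refl
  maximalPatterns-complete (c₀ ∷ c₁ ∷ []) good = good-pair c₀ c₁ (good 0 refl) (good 1 refl)
  maximalPatterns-complete (c₀ ∷ c₁ ∷ c₂ ∷ w) good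
    with Equivalence.to (good⇔head×tail c₀ c₁ c₂ w) good
  ... | head , tail with head-shape c₀ c₁ c₂ (entryAt w 0) head
  ... | x₃-free = ∈-++⁺ˡ (∈-map⁺ (λ w → I ∷ I ∷ free ∷ w) (forcedTails-complete true I w refl tail))
  ... | x₂-free = ∈-++⁺ʳ (List.map (λ w → I ∷ I ∷ free ∷ w) (forcedTails true _ _))
                    (∈-++⁺ˡ (∈-map⁺ (λ w → I ∷ free ∷ O ∷ w) (forcedTails-complete true free w tt tail)))
  ... | x₁-free = ∈-++⁺ʳ (List.map (λ w → I ∷ I ∷ free ∷ w) (forcedTails true _ _))
                    (∈-++⁺ʳ (List.map (λ w → I ∷ free ∷ O ∷ w) (forcedTails true _ _))
                      (∈-map⁺ (λ w → free ∷ O ∷ O ∷ w) (openTails-complete true w tail)))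

  map-disjoint : ∀ {A B : Set} {f g : A → B} {xs ys} → (∀ {u v} → f u ≢ g v) →
                 Disjoint (List.map f xs) (List.map g ys)
  map-disjoint f≢g (y∈₁ , y∈₂) with ∈-map⁻ _ y∈₁ | ∈-map⁻ _ y∈₂
  ... | _ , _ , refl | _ , _ , e = f≢g e

  ++-disjoint : ∀ {A : Set} {xs ys zs : List A} → Disjoint xs ys → Disjoint xs zs → Disjoint xs (ys ++ zs)
  ++-disjoint {ys = ys} xs#ys xs#zs (x∈xs , x∈ys++zs) with ∈-++⁻ ys x∈ys++zs
  ... | inj₁ x∈ys = xs#ys (x∈xs , x∈ys)
  ... | inj₂ x∈zs = xs#zs (x∈xs , x∈zs)

  maximalPatterns-unique : ∀ n k → Unique (maximalPatterns n k)
  maximalPatterns-unique 0 0                   = [] ∷ []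
  maximalPatterns-unique 0 (suc k)             = []
  maximalPatterns-unique 1 0                   = []
  maximalPatterns-unique 1 1                   = [] ∷ []
  maximalPatterns-unique 1 (suc (suc k))       = []
  maximalPatterns-unique 2 0                   = []
  maximalPatterns-unique 2 1                   = ((λ ()) ∷ []) ∷ [] ∷ []
  maximalPatterns-unique 2 (suc (suc k))       = []
  maximalPatterns-unique (suc (suc (suc m))) zero    = []
  maximalPatterns-unique (suc (suc (suc m))) (suc k) =
    Unique.++⁺ (Unique.map⁺ prefix-injective (forcedTails-unique true m k))
      (Unique.++⁺ (Unique.map⁺ prefix-injective (forcedTails-unique true m k))
                  (Unique.map⁺ prefix-injective (openTails-unique true m k))
                  (map-disjoint λ ()))
      (++-disjoint {ys = List.map (λ w → I ∷ free ∷ O ∷ w) (forcedTails true m k)}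
                   (map-disjoint λ ()) (map-disjoint λ ()))
    where
    prefix-injective : ∀ {a b c : Entry} {u v : Pattern m} →
                       _≡_ {A = Pattern (3 + m)} (a ∷ b ∷ c ∷ u) (a ∷ b ∷ c ∷ v) → u ≡ v
    prefix-injective refl = refl

  mutual
    forcedCount : ℕ → ℕ → ℕ
    forcedCount zero    zero    = 1
    forcedCount zero    (suc k) = 0
    forcedCount (suc m) k       = openCount m k

    openCount : ℕ → ℕ → ℕ
    openCount zero    zero    = 1
    openCount zero    (suc k) = 0
    openCount (suc m) zero    = 0
    openCount (suc m) (suc k) = forcedCount m k + holdCount m k

    holdCount : ℕ → ℕ → ℕ
    holdCount zero    k = 0
    holdCount (suc m) k = forcedCount m k

  cubeCount : ℕ → ℕ → ℕ
  cubeCount 0 0                         = 1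
  cubeCount 0 (suc k)                   = 0
  cubeCount 1 1                         = 1
  cubeCount 1 _                         = 0
  cubeCount 2 1                         = 2
  cubeCount 2 _                         = 0
  cubeCount (suc (suc (suc m))) zero    = 0
  cubeCount (suc (suc (suc m))) (suc k) = forcedCount m k + (forcedCount m k + openCount m k)

  mutual
    length-forcedTails : ∀ o m k → length (forcedTails o m k) ≡ forcedCount m k
    length-forcedTails o zero    zero    = refl
    length-forcedTails o zero    (suc k) = refl
    length-forcedTails o (suc m) k       =
      trans (List.length-map _ (openTails (not o) m k)) (length-openTails (not o) m k)

    length-openTails : ∀ o m k → length (openTails o m k) ≡ openCount m k
    length-openTails o zero    zero    = refl
    length-openTails o zero    (suc k) = refl
    length-openTails o (suc m) zero    = refl
    length-openTails o (suc m) (suc k) = begin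
      length (List.map (free ∷_) (forcedTails (not o) m k) ++ holdTails o m k)
        ≡⟨ List.length-++ (List.map (free ∷_) (forcedTails (not o) m k)) ⟩
      length (List.map (free ∷_) (forcedTails (not o) m k)) + length (holdTails o m k)
        ≡⟨ cong₂ _+_ (trans (List.length-map _ (forcedTails (not o) m k)) (length-forcedTails (not o) m k))
                     (length-holdTails o m k) ⟩
      forcedCount m k + holdCount m k ∎
      where open ≡-Reasoning

    length-holdTails : ∀ o m k → length (holdTails o m k) ≡ holdCount m k
    length-holdTails o zero    k = refl
    length-holdTails o (suc m) k = trans (List.length-map _ (forcedTails o m k)) (length-forcedTails o m k)

  length-maximalPatterns : ∀ n k → length (maximalPatterns n k) ≡ cubeCount n k
  length-maximalPatterns 0 0                   = refl
  length-maximalPatterns 0 (suc k)             = refl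
  length-maximalPatterns 1 0                   = refl
  length-maximalPatterns 1 1                   = refl
  length-maximalPatterns 1 (suc (suc k))       = refl
  length-maximalPatterns 2 0                   = refl
  length-maximalPatterns 2 1                   = refl
  length-maximalPatterns 2 (suc (suc k))       = refl
  length-maximalPatterns (suc (suc (suc m))) zero    = refl
  length-maximalPatterns (suc (suc (suc m))) (suc k) =
    trans (List.length-++ (List.map (λ w → I ∷ I ∷ free ∷ w) (forcedTails true m k)))
      (cong₂ _+_ (mapped-length (forcedTails true m k) (length-forcedTails true m k))
        (trans (List.length-++ (List.map (λ w → I ∷ free ∷ O ∷ w) (forcedTails true m k)))
          (cong₂ _+_ (mapped-length (forcedTails true m k) (length-forcedTails true m k))
                     (mapped-length (openTails true m k) (length-openTails true m k)))))
    where
    mapped-length : ∀ {A : Set} {c : ℕ} {f : A → Pattern (3 + m)} (xs : List A) → length xs ≡ c →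
                    length (List.map f xs) ≡ c
    mapped-length xs eq = trans (List.length-map _ xs) eq

  maxCubes-counted : ∀ n k → MaxCubeCount n k (cubeCount n k)
  maxCubes-counted n k = List.map subcube (maximalPatterns n k) , counted , maxCubes , distinct , complete
    where
    counted : length (List.map subcube (maximalPatterns n k)) ≡ cubeCount n k
    counted = trans (List.length-map subcube (maximalPatterns n k)) (length-maximalPatterns n k)

    maxCubes : All (IsMaxCube n k) (List.map subcube (maximalPatterns n k))
    maxCubes = All.map⁺ (All.tabulate λ {π} π∈ →
      let (good , dimension) = maximalPatterns-sound n k π∈ in
      subst (λ j → IsMaxCube n j (subcube π)) dimension
            (maximal-maxCube π (Equivalence.from (maximal⇔good π) good)))

    distinct : AllPairs.AllPairs (λ χ ψ → ¬ (χ ≗ᵥ ψ)) (List.map subcube (maximalPatterns n k))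
    distinct = AllPairs.map⁺ (AllPairs.map (λ {π} {σ} π≢σ same → π≢σ (subcube-injective π σ same))
                                           (maximalPatterns-unique n k))

    complete : ∀ χ → IsMaxCube n k χ → Any (χ ≗ᵥ_) (List.map subcube (maximalPatterns n k))
    complete χ maxCube =
      let (π , dimension , maximal , spans) = maxCube-maximal maxCube
          π∈ = subst (λ j → π ∈ maximalPatterns n j) dimension
                     (maximalPatterns-complete π (Equivalence.to (maximal⇔good π) maximal))
      in Any.map⁺ (Any.map (λ { refl → spans }) π∈)

  cubeCount-recurrence : ∀ m k → cubeCount (6 + m) (suc k) ≡ cubeCount (4 + m) k + cubeCount (3 + m) k
  cubeCount-recurrence m zero    = refl
  cubeCount-recurrence m (suc k) = rearrange (openCount m k) (forcedCount m k) (openCount (suc m) k)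
    where
    rearrange : ∀ g f g′ → (g + f) + ((g + f) + (g′ + g)) ≡ (g + (g + g′)) + (f + (f + g))
    rearrange = solve-∀

module GeneratingFunction where

  open import Data.Integer using (ℤ; +_; -_; 0ℤ; 1ℤ; _+_; _*_)
  import Data.Integer.Properties as ℤ
  open import Algebra.Properties.CommutativeSemigroup ℤ.+-commutativeSemigroup using (interchange)
  open import Data.Nat as ℕ using (zero; suc; _∸_; _≤_; z≤n)
  import Data.Nat.Properties as ℕ
  open import Function using (_∘_)
  open import Relation.Binary.Bundles using (Setoid)
  import Relation.Binary.Reasoning.Setoid
  open import Relation.Binary.PropositionalEquality
  open MaximalCubes using (cubeCount; cubeCount-recurrence)

  sumTo-cong : ∀ n {f g : ℕ → ℤ} → (∀ i → i ≤ n → f i ≡ g i) → sumTo n f ≡ sumTo n g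
  sumTo-cong zero    eq = eq 0 z≤n
  sumTo-cong (suc n) eq = cong₂ _+_ (sumTo-cong n λ i i≤n → eq i (ℕ.m≤n⇒m≤1+n i≤n)) (eq (suc n) ℕ.≤-refl)

  sumTo-+ : ∀ n (f g : ℕ → ℤ) → sumTo n (λ i → f i + g i) ≡ sumTo n f + sumTo n g
  sumTo-+ zero    f g = refl
  sumTo-+ (suc n) f g = trans (cong (_+ (f (suc n) + g (suc n))) (sumTo-+ n f g))
                              (interchange (sumTo n f) (sumTo n g) (f (suc n)) (g (suc n)))

  sumTo-* : ∀ n c (f : ℕ → ℤ) → sumTo n (λ i → c * f i) ≡ c * sumTo n f
  sumTo-* zero    c f = refl
  sumTo-* (suc n) c f = trans (cong (_+ c * f (suc n)) (sumTo-* n c f))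
                              (sym (ℤ.*-distribˡ-+ c (sumTo n f) (f (suc n))))

  sumTo-zero : ∀ n → sumTo n (λ _ → 0ℤ) ≡ 0ℤ
  sumTo-zero zero    = refl
  sumTo-zero (suc n) = cong (_+ 0ℤ) (sumTo-zero n)

  sumTo-suc : ∀ n (f : ℕ → ℤ) → sumTo (suc n) f ≡ f 0 + sumTo n (f ∘ suc)
  sumTo-suc zero    f = refl
  sumTo-suc (suc n) f = trans (cong (_+ f (suc (suc n))) (sumTo-suc n f))
                              (ℤ.+-assoc (f 0) (sumTo n (f ∘ suc)) (f (suc (suc n))))

  sumTo-reverse : ∀ n (f : ℕ → ℤ) → sumTo n f ≡ sumTo n (λ i → f (n ∸ i))
  sumTo-reverse zero    f = refl
  sumTo-reverse (suc n) f = begin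
    sumTo n f + f (suc n)                       ≡⟨ cong (_+ f (suc n)) (sumTo-reverse n f) ⟩
    sumTo n (λ i → f (n ∸ i)) + f (suc n)       ≡⟨ ℤ.+-comm _ (f (suc n)) ⟩
    f (suc n) + sumTo n (λ i → f (n ∸ i))       ≡⟨ sumTo-suc n (λ i → f (suc n ∸ i)) ⟨
    sumTo (suc n) (λ i → f (suc n ∸ i))         ∎
    where open ≡-Reasoning

  infix 4 _≈_

  -- A record around _≋_, so that Agda can infer the series being compared.
  record _≈_ (s t : Ser) : Set where
    constructor coefficientwise
    field coefficient : s ≋ t

  open _≈_

  ≈-setoid : Setoid _ _
  ≈-setoid = record
    { Carrier       = Ser
    ; _≈_           = _≈_
    ; isEquivalence = record
      { refl  = coefficientwise λ n k → refl
      ; sym   = λ (coefficientwise eq) → coefficientwise λ n k → sym (eq n k)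
      ; trans = λ (coefficientwise eq) (coefficientwise eq′) →
                  coefficientwise λ n k → trans (eq n k) (eq′ n k)
      }
    }

  open Setoid ≈-setoid using () renaming (refl to ≈-refl; sym to ≈-sym; trans to ≈-trans)
  module ≈-Reasoning = Relation.Binary.Reasoning.Setoid ≈-setoid

  infixr 8 _·_

  _·_ : ℤ → Ser → Ser
  (c · s) n k = c * s n k

  yShift xShift : Ser → Ser
  yShift s zero    k       = 0ℤ
  yShift s (suc n) k       = s n k
  xShift s n       zero    = 0ℤ
  xShift s n       (suc k) = s n k

  ⊕-cong : ∀ {s s′ t t′} → s ≈ s′ → t ≈ t′ → s ⊕ t ≈ s′ ⊕ t′
  ⊕-cong (coefficientwise eq) (coefficientwise eq′) = coefficientwise λ n k → cong₂ _+_ (eq n k) (eq′ n k)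

  ⊖-cong : ∀ {s s′} → s ≈ s′ → ⊖ s ≈ ⊖ s′
  ⊖-cong (coefficientwise eq) = coefficientwise λ n k → cong -_ (eq n k)

  ⊛-cong : ∀ {s s′ t t′} → s ≈ s′ → t ≈ t′ → s ⊛ t ≈ s′ ⊛ t′
  ⊛-cong (coefficientwise eq) (coefficientwise eq′) = coefficientwise λ n k →
    sumTo-cong n λ i _ → sumTo-cong k λ j _ → cong₂ _*_ (eq i j) (eq′ (n ∸ i) (k ∸ j))

  ⊛-congˡ : ∀ {s s′} t → s ≈ s′ → s ⊛ t ≈ s′ ⊛ t
  ⊛-congˡ t eq = ⊛-cong eq (≈-refl {t})

  ·-cong : ∀ c {s s′} → s ≈ s′ → c · s ≈ c · s′
  ·-cong c (coefficientwise eq) = coefficientwise λ n k → cong (c *_) (eq n k)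

  yShift-cong : ∀ {s s′} → s ≈ s′ → yShift s ≈ yShift s′
  yShift-cong (coefficientwise eq) = coefficientwise λ where
    zero    k → refl
    (suc n) k → eq n k

  xShift-cong : ∀ {s s′} → s ≈ s′ → xShift s ≈ xShift s′
  xShift-cong (coefficientwise eq) = coefficientwise λ where
    n zero    → refl
    n (suc k) → eq n k

  -- Reversing both summations swaps the roles of the two factors.
  ⊛-comm : ∀ s t → s ⊛ t ≈ t ⊛ s
  ⊛-comm s t = coefficientwise λ n k → begin
    sumTo n (λ i → sumTo k (λ j → s i j * t (n ∸ i) (k ∸ j)))
      ≡⟨ sumTo-reverse n (λ i → sumTo k (λ j → s i j * t (n ∸ i) (k ∸ j))) ⟩
    sumTo n (λ i → sumTo k (λ j → s (n ∸ i) j * t (n ∸ (n ∸ i)) (k ∸ j)))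
      ≡⟨ sumTo-cong n (λ i i≤n → trans (sumTo-reverse k (λ j → s (n ∸ i) j * t (n ∸ (n ∸ i)) (k ∸ j)))
           (sumTo-cong k λ j j≤k → trans (ℤ.*-comm (s (n ∸ i) (k ∸ j)) (t (n ∸ (n ∸ i)) (k ∸ (k ∸ j))))
             (cong₂ (λ a b → t a b * s (n ∸ i) (k ∸ j)) (ℕ.m∸[m∸n]≡n i≤n) (ℕ.m∸[m∸n]≡n j≤k)))) ⟩
    sumTo n (λ i → sumTo k (λ j → t i j * s (n ∸ i) (k ∸ j))) ∎
    where open ≡-Reasoning

  ⊛-distribʳ-⊕ : ∀ s t u → (s ⊕ t) ⊛ u ≈ s ⊛ u ⊕ t ⊛ u
  ⊛-distribʳ-⊕ s t u = coefficientwise λ n k →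
    trans (sumTo-cong n λ i _ → trans (sumTo-cong k λ j _ → ℤ.*-distribʳ-+ (u (n ∸ i) (k ∸ j)) (s i j) (t i j))
                                      (sumTo-+ k _ _))
          (sumTo-+ n _ _)

  sumTo-⊛-zero : ∀ n k (f : ℕ → ℕ → ℤ) → sumTo n (λ i → sumTo k (λ j → 0ℤ * f i j)) ≡ 0ℤ
  sumTo-⊛-zero n k f = trans (sumTo-cong n λ i _ → trans (sumTo-cong k λ j _ → ℤ.*-zeroˡ (f i j)) (sumTo-zero k))
                             (sumTo-zero n)

  ·-⊛ : ∀ c s t → (c · s) ⊛ t ≈ c · (s ⊛ t)
  ·-⊛ c s t = coefficientwise λ n k →
    trans (sumTo-cong n λ i _ → trans (sumTo-cong k λ j _ → ℤ.*-assoc c (s i j) (t (n ∸ i) (k ∸ j))) (sumTo-* k c _))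
          (sumTo-* n c _)

  yShift-⊛ : ∀ s t → yShift s ⊛ t ≈ yShift (s ⊛ t)
  yShift-⊛ s t = coefficientwise λ where
    zero    k → sumTo-⊛-zero 0 k λ _ j → t 0 (k ∸ j)
    (suc n) k → trans (sumTo-suc n _)
                      (trans (cong (_+ (s ⊛ t) n k) (sumTo-⊛-zero 0 k λ _ j → t (suc n) (k ∸ j))) (ℤ.+-identityˡ _))

  xShift-⊛ : ∀ s t → xShift s ⊛ t ≈ xShift (s ⊛ t)
  xShift-⊛ s t = coefficientwise λ where
    n zero    → sumTo-⊛-zero n 0 λ i _ → t (n ∸ i) 0
    n (suc k) → sumTo-cong n λ i _ →
      trans (sumTo-suc k _) (trans (cong (_+ sumTo k (λ j → s i j * t (n ∸ i) (k ∸ j))) (ℤ.*-zeroˡ (t (n ∸ i) (suc k))))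
                                   (ℤ.+-identityˡ _))

  𝟙-row : ∀ k (f : ℕ → ℤ) → sumTo k (λ j → 𝟙 0 j * f (k ∸ j)) ≡ f k
  𝟙-row zero    f = ℤ.*-identityˡ (f 0)
  𝟙-row (suc k) f = begin
    sumTo (suc k) (λ j → 𝟙 0 j * f (suc k ∸ j))      ≡⟨ sumTo-suc k _ ⟩
    1ℤ * f (suc k) + sumTo k (λ j → 0ℤ * f (k ∸ j))
      ≡⟨ cong₂ _+_ (ℤ.*-identityˡ (f (suc k))) (sumTo-⊛-zero 0 k λ _ j → f (k ∸ j)) ⟩
    f (suc k) + 0ℤ                                  ≡⟨ ℤ.+-identityʳ _ ⟩
    f (suc k)                                       ∎
    where open ≡-Reasoning

  𝟙-⊛ : ∀ s → 𝟙 ⊛ s ≈ s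
  𝟙-⊛ s = coefficientwise λ where
    zero    k → 𝟙-row k (s 0)
    (suc n) k → trans (sumTo-suc n _)
                  (trans (cong₂ _+_ (𝟙-row k (s (suc n))) (sumTo-⊛-zero n k λ i j → s (n ∸ i) (k ∸ j)))
                         (ℤ.+-identityʳ _))

  ⊖≈-1· : ∀ s → ⊖ s ≈ (- 1ℤ) · s
  ⊖≈-1· s = coefficientwise λ n k → sym (ℤ.-1*i≡-i (s n k))

  ⊖-⊛ : ∀ s t → ⊖ s ⊛ t ≈ ⊖ (s ⊛ t)
  ⊖-⊛ s t = begin
    ⊖ s ⊛ t           ≈⟨ ⊛-congˡ t (⊖≈-1· s) ⟩
    ((- 1ℤ) · s) ⊛ t  ≈⟨ ·-⊛ (- 1ℤ) s t ⟩
    (- 1ℤ) · (s ⊛ t)  ≈⟨ ⊖≈-1· (s ⊛ t) ⟨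
    ⊖ (s ⊛ t)         ∎
    where open ≈-Reasoning

  X≈xShift𝟙 : X ≈ xShift 𝟙
  X≈xShift𝟙 = coefficientwise λ where
    zero    zero          → refl
    zero    (suc zero)    → refl
    zero    (suc (suc k)) → refl
    (suc n) zero          → refl
    (suc n) (suc zero)    → refl
    (suc n) (suc (suc k)) → refl

  Y≈yShift𝟙 : Y ≈ yShift 𝟙
  Y≈yShift𝟙 = coefficientwise λ where
    zero          k       → refl
    (suc zero)    zero    → refl
    (suc zero)    (suc k) → refl
    (suc (suc n)) zero    → refl
    (suc (suc n)) (suc k) → refl

  const≈·𝟙 : ∀ c → const c ≈ c · 𝟙
  const≈·𝟙 c = coefficientwise λ where
    zero    zero    → sym (ℤ.*-identityʳ c)
    zero    (suc k) → sym (ℤ.*-zeroʳ c)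
    (suc n) k       → sym (ℤ.*-zeroʳ c)

  infixl 6 _`+_ _`-_
  infixl 7 _`*_
  infixr 8 _`^_

  data Expr : Set where
    `1 `2 `x `y    : Expr
    _`+_ _`-_ _`*_ : Expr → Expr → Expr
    `-_            : Expr → Expr
    _`^_           : Expr → ℕ → Expr

  ⟦_⟧ : Expr → Ser
  ⟦ `1 ⟧     = 𝟙
  ⟦ `2 ⟧     = const (+ 2)
  ⟦ `x ⟧     = X
  ⟦ `y ⟧     = Y
  ⟦ a `+ b ⟧ = ⟦ a ⟧ ⊕ ⟦ b ⟧
  ⟦ a `- b ⟧ = ⟦ a ⟧ ⊝ ⟦ b ⟧
  ⟦ a `* b ⟧ = ⟦ a ⟧ ⊛ ⟦ b ⟧
  ⟦ `- a ⟧   = ⊖ ⟦ a ⟧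
  ⟦ a `^ m ⟧ = ⟦ a ⟧ ^ˢ m

  -- Multiplication by ⟦ e ⟧, by shifts and scalings only, so that coefficients compute.
  act : Expr → Ser → Ser
  act `1           s = s
  act `2           s = (+ 2) · s
  act `x           s = xShift s
  act `y           s = yShift s
  act (a `+ b)     s = act a s ⊕ act b s
  act (a `- b)     s = act a s ⊝ act b s
  act (a `* b)     s = act a (act b s)
  act (`- a)       s = ⊖ (act a s)
  act (a `^ zero)  s = s
  act (a `^ suc m) s = act a (act (a `^ m) s)

  act-cong : ∀ e {s s′} → s ≈ s′ → act e s ≈ act e s′
  act-cong `1           eq = eq
  act-cong `2           eq = ·-cong (+ 2) eq
  act-cong `x           eq = xShift-cong eq
  act-cong `y           eq = yShift-cong eq
  act-cong (a `+ b)     eq = ⊕-cong (act-cong a eq) (act-cong b eq)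
  act-cong (a `- b)     eq = ⊕-cong (act-cong a eq) (⊖-cong (act-cong b eq))
  act-cong (a `* b)     eq = act-cong a (act-cong b eq)
  act-cong (`- a)       eq = ⊖-cong (act-cong a eq)
  act-cong (a `^ zero)  eq = eq
  act-cong (a `^ suc m) eq = act-cong a (act-cong (a `^ m) eq)

  act-⊛ : ∀ e s t → act e s ⊛ t ≈ act e (s ⊛ t)
  act-⊛ `1           s t = ≈-refl
  act-⊛ `2           s t = ·-⊛ (+ 2) s t
  act-⊛ `x           s t = xShift-⊛ s t
  act-⊛ `y           s t = yShift-⊛ s t
  act-⊛ (a `+ b)     s t = ≈-trans (⊛-distribʳ-⊕ (act a s) (act b s) t) (⊕-cong (act-⊛ a s t) (act-⊛ b s t))
  act-⊛ (a `- b)     s t = ≈-trans (⊛-distribʳ-⊕ (act a s) (⊖ (act b s)) t)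
                             (⊕-cong (act-⊛ a s t) (≈-trans (⊖-⊛ (act b s) t) (⊖-cong (act-⊛ b s t))))
  act-⊛ (a `* b)     s t = ≈-trans (act-⊛ a (act b s) t) (act-cong a (act-⊛ b s t))
  act-⊛ (`- a)       s t = ≈-trans (⊖-⊛ (act a s) t) (⊖-cong (act-⊛ a s t))
  act-⊛ (a `^ zero)  s t = ≈-refl
  act-⊛ (a `^ suc m) s t = ≈-trans (act-⊛ a (act (a `^ m) s) t) (act-cong a (act-⊛ (a `^ m) s t))

  ⟦⟧-⊛ : ∀ e s → ⟦ e ⟧ ⊛ s ≈ act e s
  ⟦⟧-⊛ `1           s = 𝟙-⊛ s
  ⟦⟧-⊛ `2           s = ≈-trans (⊛-congˡ s (const≈·𝟙 (+ 2))) (≈-trans (·-⊛ (+ 2) 𝟙 s) (·-cong (+ 2) (𝟙-⊛ s)))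
  ⟦⟧-⊛ `x           s = ≈-trans (⊛-congˡ s X≈xShift𝟙) (≈-trans (xShift-⊛ 𝟙 s) (xShift-cong (𝟙-⊛ s)))
  ⟦⟧-⊛ `y           s = ≈-trans (⊛-congˡ s Y≈yShift𝟙) (≈-trans (yShift-⊛ 𝟙 s) (yShift-cong (𝟙-⊛ s)))
  ⟦⟧-⊛ (a `+ b)     s = ≈-trans (⊛-distribʳ-⊕ ⟦ a ⟧ ⟦ b ⟧ s) (⊕-cong (⟦⟧-⊛ a s) (⟦⟧-⊛ b s))
  ⟦⟧-⊛ (a `- b)     s = ≈-trans (⊛-distribʳ-⊕ ⟦ a ⟧ (⊖ ⟦ b ⟧) s)
                          (⊕-cong (⟦⟧-⊛ a s) (≈-trans (⊖-⊛ ⟦ b ⟧ s) (⊖-cong (⟦⟧-⊛ b s))))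
  ⟦⟧-⊛ (a `* b)     s = ≈-trans (⊛-congˡ s (⟦⟧-⊛ a ⟦ b ⟧)) (≈-trans (act-⊛ a ⟦ b ⟧ s) (act-cong a (⟦⟧-⊛ b s)))
  ⟦⟧-⊛ (`- a)       s = ≈-trans (⊖-⊛ ⟦ a ⟧ s) (⊖-cong (⟦⟧-⊛ a s))
  ⟦⟧-⊛ (a `^ zero)  s = 𝟙-⊛ s
  ⟦⟧-⊛ (a `^ suc m) s = ≈-trans (⊛-congˡ s (⟦⟧-⊛ a ⟦ a `^ m ⟧))
                          (≈-trans (act-⊛ a ⟦ a `^ m ⟧ s) (act-cong a (⟦⟧-⊛ (a `^ m) s)))

  ⟦⟧≈act𝟙 : ∀ e → ⟦ e ⟧ ≈ act e 𝟙
  ⟦⟧≈act𝟙 e = ≈-trans (≈-sym (𝟙-⊛ ⟦ e ⟧)) (≈-trans (⊛-comm 𝟙 ⟦ e ⟧) (⟦⟧-⊛ e 𝟙))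

  numerator denominator polynomialPart expansion : Expr
  numerator      = `1 `+ `x `* `y `* (`1 `+ `y) `+ `2 `* `x `* `y `^ 3 `* (`1 `+ `y)
                   `- `x `^ 2 `* `y `^ 3 `* (`1 `+ `y) `^ 2
  denominator    = `1 `- `x `* `y `^ 2 `* (`1 `+ `y)
  polynomialPart = `- (`2 `* `y) `+ `x `* `y `+ `x `* `y `^ 2
  expansion      = polynomialPart `* denominator `+ (`1 `+ `y `+ `y)

  -- Both sides are polynomials of y-degree ≤ 5 and x-degree ≤ 2, so the coefficients
  -- are compared on the cases below by evaluation.
  numerator-coefficients : act numerator 𝟙 ≋ act expansion 𝟙
  numerator-coefficients 0 0 = refl
  numerator-coefficients 0 1 = refl
  numerator-coefficients 0 2 = refl
  numerator-coefficients 0 (suc (suc (suc k))) = refl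
  numerator-coefficients 1 0 = refl
  numerator-coefficients 1 1 = refl
  numerator-coefficients 1 2 = refl
  numerator-coefficients 1 (suc (suc (suc k))) = refl
  numerator-coefficients 2 0 = refl
  numerator-coefficients 2 1 = refl
  numerator-coefficients 2 2 = refl
  numerator-coefficients 2 (suc (suc (suc k))) = refl
  numerator-coefficients 3 0 = refl
  numerator-coefficients 3 1 = refl
  numerator-coefficients 3 2 = refl
  numerator-coefficients 3 (suc (suc (suc k))) = refl
  numerator-coefficients 4 0 = refl
  numerator-coefficients 4 1 = refl
  numerator-coefficients 4 2 = refl
  numerator-coefficients 4 (suc (suc (suc k))) = refl
  numerator-coefficients 5 0 = refl
  numerator-coefficients 5 1 = refl
  numerator-coefficients 5 2 = refl
  numerator-coefficients 5 (suc (suc (suc k))) = refl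
  numerator-coefficients (suc (suc (suc (suc (suc (suc n)))))) 0 = refl
  numerator-coefficients (suc (suc (suc (suc (suc (suc n)))))) 1 = refl
  numerator-coefficients (suc (suc (suc (suc (suc (suc n)))))) 2 = refl
  numerator-coefficients (suc (suc (suc (suc (suc (suc n)))))) (suc (suc (suc k))) = refl

  numerator-identity : Num ≋ Pol ⊛ Den ⊕ (𝟙 ⊕ Y ⊕ Y)
  numerator-identity = coefficient (begin
    Num                      ≈⟨ ⟦⟧≈act𝟙 numerator ⟩
    act numerator 𝟙          ≈⟨ coefficientwise numerator-coefficients ⟩
    act expansion 𝟙          ≈⟨ ⟦⟧≈act𝟙 expansion ⟨
    Pol ⊛ Den ⊕ (𝟙 ⊕ Y ⊕ Y)  ∎)
    where open ≈-Reasoning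

  cancel : ∀ a b c → a ≡ b ℕ.+ c → (+ a) + - ((+ b) + (+ c)) ≡ 0ℤ
  cancel _ b c refl = ℤ.+-inverseʳ (+ (b ℕ.+ c))

  numerator-vanishes : ∀ m k → act numerator 𝟙 (6 ℕ.+ m) k ≡ 0ℤ
  numerator-vanishes m 0                   = refl
  numerator-vanishes m 1                   = refl
  numerator-vanishes m 2                   = refl
  numerator-vanishes m (suc (suc (suc k))) = refl

  denominator-coefficients : act denominator (genSer cubeCount) ≋ act numerator 𝟙
  denominator-coefficients 0 0 = refl
  denominator-coefficients 0 1 = refl
  denominator-coefficients 0 2 = refl
  denominator-coefficients 0 (suc (suc (suc k))) = refl
  denominator-coefficients 1 0 = refl
  denominator-coefficients 1 1 = refl
  denominator-coefficients 1 2 = refl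
  denominator-coefficients 1 (suc (suc (suc k))) = refl
  denominator-coefficients 2 0 = refl
  denominator-coefficients 2 1 = refl
  denominator-coefficients 2 2 = refl
  denominator-coefficients 2 (suc (suc (suc k))) = refl
  denominator-coefficients 3 0 = refl
  denominator-coefficients 3 1 = refl
  denominator-coefficients 3 2 = refl
  denominator-coefficients 3 (suc (suc (suc k))) = refl
  denominator-coefficients 4 0 = refl
  denominator-coefficients 4 1 = refl
  denominator-coefficients 4 2 = refl
  denominator-coefficients 4 (suc (suc (suc k))) = refl
  denominator-coefficients 5 0 = refl
  denominator-coefficients 5 1 = refl
  denominator-coefficients 5 2 = refl
  denominator-coefficients 5 (suc (suc (suc k))) = refl
  denominator-coefficients (suc (suc (suc (suc (suc (suc m)))))) 0       = sym (numerator-vanishes m 0)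
  denominator-coefficients (suc (suc (suc (suc (suc (suc m)))))) (suc k) =
    trans (cancel _ (cubeCount (4 ℕ.+ m) k) (cubeCount (3 ℕ.+ m) k) (cubeCount-recurrence m k))
          (sym (numerator-vanishes m (suc k)))

  generating-function : genSer cubeCount ⊛ Den ≋ Num
  generating-function = coefficient (begin
    genSer cubeCount ⊛ Den              ≈⟨ ⊛-comm (genSer cubeCount) Den ⟩
    Den ⊛ genSer cubeCount              ≈⟨ ⟦⟧-⊛ denominator (genSer cubeCount) ⟩
    act denominator (genSer cubeCount)  ≈⟨ coefficientwise denominator-coefficients ⟩
    act numerator 𝟙                     ≈⟨ ⟦⟧≈act𝟙 numerator ⟨
    Num                                 ∎)
    where open ≈-Reasoning

open MaximalCubes using (cubeCount; maxCubes-counted)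
open GeneratingFunction using (generating-function; numerator-identity)

theorem5 : Σ (ℕ → ℕ → ℕ) λ h →
    (∀ n k → MaxCubeCount n k (h n k)) ×
    (genSer h ⊛ Den ≋ Num) ×
    (Num ≋ Pol ⊛ Den ⊕ (𝟙 ⊕ Y ⊕ Y))
theorem5 = cubeCount , maxCubes-counted , generating-function , numerator-identity
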